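{- In the stratified type and effect system, if $R;\Gamma\vdash M:(B,e)$ then $R;\Gamma\models M:(B,e)$; that is, writing $\Gamma=x_1:A_1,\ldots,x_n:A_n$, for every $R'\ge R$ and all values $V_1,\ldots,V_n$ with $R'\vdash V_i\in[\![R\vdash(A_i,\emptyset)]\!]$ for $i=1,\ldots,n$, we have $R'\vdash[V_1/x_1,\ldots,V_n/x_n]M\in[\![R\vdash(B,e)]\!]$.
   Context: Syntax. Regions $r,s,\ldots$; effects $e$ are finite sets of regions. Types: $A ::= \mathbf{1} \mid \mathrm{Reg}_r A \mid A\xrightarrow{e}A$. Region contexts $R=r_1:A_1,\ldots,r_n:A_n$, $\mathrm{dom}(R)=\{r_1,\ldots,r_n\}$; contexts $\Gamma=x_1:A_1,\ldots,x_n:A_n$. Terms $M ::= x\mid r\mid *\mid \lambda x.M\mid MM\mid \mathsf{get}(M)\mid\mathsf{set}(M,M)$; values $V::= r\mid *\mid \lambda x.M$; $[V_1/x_1,\ldots]M$ is simultaneous substitution. A store is a finite collection of bindings $r\Leftarrow v$ with $v$ a set of values ($r\Leftarrow v_1,r\Leftarrow v_2$ identified with $r\Leftarrow v_1\cup v_2$, $r\Leftarrow V$ meaning $r\Leftarrow\{V\}$); $\mathrm{dom}(S)$ is the set of bound regions, $S(r)$ the set of values bound to $r$. Reduction. Evaluation contexts $E ::= [\,]\mid EM\mid VE\mid \mathsf{get}(E)\mid\mathsf{set}(E,M)\mid\mathsf{set}(V,E)$. Rules: $E[(\lambda x.M)V]\to E[[V/x]M]$; $E[\mathsf{get}(r)],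 r\Leftarrow V\to E[V], r\Leftarrow V$; $E[\mathsf{set}(r,V)]\to E[*], r\Leftarrow V$; if $P\to P'$ then $P,P''\to P',P''$. Stratified well-formedness: $\emptyset\vdash$; if $R\vdash A$, $r\notin\mathrm{dom}(R)$ then $R,r:A\vdash$; if $R\vdash$ then $R\vdash\mathbf 1$; if $R\vdash$, $r:A\in R$ then $R\vdash\mathrm{Reg}_rA$; if $R\vdash A$, $R\vdash B$, $e\subseteq\mathrm{dom}(R)$ then $R\vdash A\xrightarrow{e}B$; $R\vdash(A,e)$ iff $R\vdash A$ and $e\subseteq\mathrm{dom}(R)$; $R\vdash\Gamma$ iff $R\vdash$ and $R\vdash A_i$ for each $x_i:A_i\in\Gamma$. Subtyping: if $R\vdash A$ then $R\vdash A\le A$; if $R\vdash A'\le A$, $R\vdash B\le B'$, $e\subseteq e'\subseteq\mathrm{dom}(R)$ then $R\vdash (A\xrightarrow{e}B)\le(A'\xrightarrow{e'}B')$; if $R\vdash A\le A'$, $e\subseteq e'\subseteq\mathrm{dom}(R)$ then $R\vdash(A,e)\le(A',e')$. Typing: if $R\vdash\Gamma$, $x:A\in\Gamma$ then $R;\Gamma\vdash x:(A,\emptyset)$; if $R\vdash\Gamma$, $r:A\in R$ then $R;\Gamma\vdash r:(\mathrm{Reg}_rA,\emptyset)$; if $R\vdash\Gamma$ then $R;\Gamma\vdash *:(\mathbf 1,\emptyset)$; from $R;\Gamma,x:A\vdash M:(B,e)$ infer $R;\Gamma\vdash\lambda x.M:(A\xrightarrow{e}B,\emptyset)$; from $R;\Gamma\vdash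 M:(A\xrightarrow{e_2}B,e_1)$ and $R;\Gamma\vdash N:(A,e_3)$ infer $R;\Gamma\vdash MN:(B,e_1\cup e_2\cup e_3)$; from $R;\Gamma\vdash M:(\mathrm{Reg}_rA,e)$ infer $R;\Gamma\vdash\mathsf{get}(M):(A,e\cup\{r\})$; from $R;\Gamma\vdash M:(\mathrm{Reg}_rA,e_1)$ and $R;\Gamma\vdash N:(A,e_2)$ infer $R;\Gamma\vdash\mathsf{set}(M,N):(\mathbf 1,e_1\cup e_2\cup\{r\})$; from $R;\Gamma\vdash M:(A,e)$ and $R\vdash(A,e)\le(A',e')$ infer $R;\Gamma\vdash M:(A',e')$. Interpretation. $SN$ is the set of single-threaded programs $M,S$ all of whose reduction sequences are finite. $(M,S)\Downarrow(N,S')$ means $M,S\to^* N,S'$ and $N,S'$ is irreducible. $R'\ge R$ means $R'\vdash$ and $R'=R,R''$ for some $R''$. For $R=r_1:A_1,\ldots,r_n:A_n$ let $R_{r_i}=r_1:A_1,\ldots,r_{i-1}:A_{i-1}$. Define, by induction on the height of the derivations of $R\vdash$ and $R\vdash(A,e)$: $[\![R]\!]$ is the set of pairs $R'\vdash S$ with $R'\ge R$, $\mathrm{dom}(S)=\mathrm{dom}(R)$ and $S(r_i)=\{V\mid R'\vdash V\in[\![R_{r_i}\vdash(A_i,\emptyset)]\!]\}$ for each $i$; $[\![R]\!](R')$ denotes the unique such $S$. $[\![R\vdash(A,e)]\!]$ is the set of pairs $R'\vdash M$ such that (1) $R'\ge R$ and $R';\emptyset\vdash M:(A,e)$; (2)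 for all $R''\ge R'$, $M,[\![R]\!](R'')\in SN$; (3) for all $R''\ge R'$ and all $M',S'$, if $(M,[\![R]\!](R''))\Downarrow(M',S')$ then $S'=[\![R]\!](R'')$ and $\mathcal C(A,R,R'',M')$, where $\mathcal C(A,R,R'',M')$ means: if $A=\mathbf 1$ then $M'=*$; if $A=\mathrm{Reg}_rB$ then $M'=r$; if $A=A_1\xrightarrow{e'}A_2$ then $M'=\lambda x.N$ for some $N$ and for all $R_1\ge R''$ and all $V$, $R_1\vdash V\in[\![R\vdash(A_1,\emptyset)]\!]$ implies $R_1\vdash M'V\in[\![R\vdash(A_2,e')]\!]$. -}

module Defs where

open import Data.Nat using (ℕ; zero; suc)
open import Data.Fin using (Fin; zero; suc)
open import Data.List using (List; []; _∷_; _++_; map)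
open import Data.List.Membership.Propositional using (_∈_; _∉_)
open import Data.List.Relation.Binary.Subset.Propositional using (_⊆_)
open import Data.Vec using (Vec; []; _∷_; lookup)
open import Data.Product using (Σ; _×_; _,_; proj₁)
open import Data.Sum using (_⊎_)
open import Data.Empty using (⊥)
open import Relation.Binary.PropositionalEquality using (_≡_)
open import Relation.Binary.Construct.Closure.ReflexiveTransitive using (Star)
open import Induction.WellFounded using (Acc)
open import Relation.Nullary using (¬_)

-- Regions are names (natural numbers); effects are finite sets of
-- regions, represented by lists (membership = element of the set).
Region : Set
Region = ℕ

Eff : Set
Eff = List Region

∅ₑ : Eff
∅ₑ = []

infixr 20 _⟶[_]_
data Ty : Set where
  𝟙      : Ty
  Reg    : Region → Ty → Ty
  _⟶[_]_ : Ty → Eff → Ty → Ty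

data Term (n : ℕ) : Set where
  var  : Fin n → Term n
  reg  : Region → Term n
  unit : Term n
  lam  : Term (suc n) → Term n
  app  : Term n → Term n → Term n
  get  : Term n → Term n
  set  : Term n → Term n → Term n

data Val {n : ℕ} : Term n → Set where
  v-reg  : ∀ {r} → Val (reg r)
  v-unit : Val unit
  v-lam  : ∀ {M} → Val (lam M)

ext : ∀ {m n} → (Fin m → Fin n) → Fin (suc m) → Fin (suc n)
ext ρ zero    = zero
ext ρ (suc i) = suc (ρ i)

rename : ∀ {m n} → (Fin m → Fin n) → Term m → Term n
rename ρ (var i)   = var (ρ i)
rename ρ (reg r)   = reg r
rename ρ unit      = unit
rename ρ (lam M)   = lam (rename (ext ρ) M)
rename ρ (app M N) = app (rename ρ M) (rename ρ N)
rename ρ (get M)   = get (rename ρ M)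
rename ρ (set M N) = set (rename ρ M) (rename ρ N)

exts : ∀ {m n} → (Fin m → Term n) → Fin (suc m) → Term (suc n)
exts σ zero    = var zero
exts σ (suc i) = rename suc (σ i)

subst : ∀ {m n} → (Fin m → Term n) → Term m → Term n
subst σ (var i)   = σ i
subst σ (reg r)   = reg r
subst σ unit      = unit
subst σ (lam M)   = lam (subst (exts σ) M)
subst σ (app M N) = app (subst σ M) (subst σ N)
subst σ (get M)   = get (subst σ M)
subst σ (set M N) = set (subst σ M) (subst σ N)

_[_] : ∀ {n} → Term (suc n) → Term n → Term n
M [ V ] = subst σ M
  where
  σ : _ → _
  σ zero    = V
  σ (suc i) = var i

-- A store: the set of bound regions, and for each region the set of
-- values bound to it.
record Store : Set₁ where
  field
    dom : Region → Set
    val : Region → Term 0 → Set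
open Store public

Binding : Set
Binding = Region × Term 0

_⊕_ : Store → List Binding → Store
dom (S ⊕ Δ) r   = dom S r ⊎ r ∈ map proj₁ Δ
val (S ⊕ Δ) r V = val S r V ⊎ (r , V) ∈ Δ

-- extensional equality of stores (they are collections of sets)
_≈ˢ_ : Store → Store → Set
S ≈ˢ S' = (∀ r → (dom S r → dom S' r) × (dom S' r → dom S r))
        × (∀ r V → (val S r V → val S' r V) × (val S' r V → val S r V))

data ECtx : Set where
  hole : ECtx
  appL : ECtx → Term 0 → ECtx
  appR : (V : Term 0) → Val V → ECtx → ECtx
  getC : ECtx → ECtx
  setL : ECtx → Term 0 → ECtx
  setR : (V : Term 0) → Val V → ECtx → ECtx

plug : ECtx → Term 0 → Term 0
plug hole         P = P
plug (appL E M)   P = app (plug E P) M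
plug (appR V _ E) P = app V (plug E P)
plug (getC E)     P = get (plug E P)
plug (setL E M)   P = set (plug E P) M
plug (setR V _ E) P = set V (plug E P)

-- Configurations reachable from a program  M , S  have stores of the form
-- S ⊕ Δ (reduction only adds bindings), so we index configurations by
-- the term and the list Δ of bindings added to the base store S.
Conf : Set
Conf = Term 0 × List Binding

data Step (S : Store) : Conf → Conf → Set where
  β-step   : ∀ {E M V Δ} → Val V →
             Step S (plug E (app (lam M) V) , Δ) (plug E (M [ V ]) , Δ)
  get-step : ∀ {E r V Δ} → val (S ⊕ Δ) r V →
             Step S (plug E (get (reg r)) , Δ) (plug E V , Δ)
  set-step : ∀ {E r V Δ} → Val V →
             Step S (plug E (set (reg r) V) , Δ) (plug E unit , (r , V) ∷ Δ)

SN : Term 0 → Store → Set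
SN M S = Acc (λ c' c → Step S c c') (M , [])

Irreducible : Store → Conf → Set
Irreducible S c = ∀ c' → ¬ Step S c c'

_,_⇓_,_ : Term 0 → Store → Term 0 → List Binding → Set
M , S ⇓ M' , Δ = Star (Step S) (M , []) (M' , Δ) × Irreducible S (M' , Δ)

infixl 5 _,_∶_
data RCtx : Set where
  ε     : RCtx
  _,_∶_ : RCtx → Region → Ty → RCtx

_++ᴿ_ : RCtx → RCtx → RCtx
R ++ᴿ ε           = R
R ++ᴿ (R' , r ∶ A) = (R ++ᴿ R') , r ∶ A

domᴿ : RCtx → List Region
domᴿ ε           = []
domᴿ (R , r ∶ A) = r ∷ domᴿ R

data _∶_∈ᴿ_ : Region → Ty → RCtx → Set where
  here  : ∀ {R r A} → r ∶ A ∈ᴿ (R , r ∶ A)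
  there : ∀ {R r A s B} → r ∶ A ∈ᴿ R → r ∶ A ∈ᴿ (R , s ∶ B)

data _⊢ctx : RCtx → Set
data _⊢ty_ : RCtx → Ty → Set

data _⊢ctx where
  wf-ε   : ε ⊢ctx
  wf-ext : ∀ {R r A} → R ⊢ty A → r ∉ domᴿ R → (R , r ∶ A) ⊢ctx

data _⊢ty_ where
  wf-𝟙   : ∀ {R} → R ⊢ctx → R ⊢ty 𝟙
  wf-reg : ∀ {R r A} → R ⊢ctx → r ∶ A ∈ᴿ R → R ⊢ty Reg r A
  wf-arr : ∀ {R A B e} → R ⊢ty A → R ⊢ty B → e ⊆ domᴿ R → R ⊢ty (A ⟶[ e ] B)

_⊢_!_ : RCtx → Ty → Eff → Set
R ⊢ A ! e = R ⊢ty A × e ⊆ domᴿ R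

_⊢Γ_ : ∀ {n} → RCtx → Vec Ty n → Set
R ⊢Γ Γ = R ⊢ctx × (∀ i → R ⊢ty lookup Γ i)

data _⊢_≤_ (R : RCtx) : Ty → Ty → Set where
  ≤-refl : ∀ {A} → R ⊢ty A → R ⊢ A ≤ A
  ≤-arr  : ∀ {A A' B B' e e'} → R ⊢ A' ≤ A → R ⊢ B ≤ B' →
           e ⊆ e' → e' ⊆ domᴿ R → R ⊢ (A ⟶[ e ] B) ≤ (A' ⟶[ e' ] B')

_⊢_!_≤_!_ : RCtx → Ty → Eff → Ty → Eff → Set
R ⊢ A ! e ≤ A' ! e' = R ⊢ A ≤ A' × e ⊆ e' × e' ⊆ domᴿ R

data _﹔_⊢_∶_!_ {n : ℕ} (R : RCtx) (Γ : Vec Ty n) : Term n → Ty → Eff → Set where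
  t-var  : ∀ {i} → R ⊢Γ Γ → R ﹔ Γ ⊢ var i ∶ lookup Γ i ! ∅ₑ
  t-reg  : ∀ {r A} → R ⊢Γ Γ → r ∶ A ∈ᴿ R → R ﹔ Γ ⊢ reg r ∶ Reg r A ! ∅ₑ
  t-unit : R ⊢Γ Γ → R ﹔ Γ ⊢ unit ∶ 𝟙 ! ∅ₑ
  t-lam  : ∀ {M A B e} → R ﹔ (A ∷ Γ) ⊢ M ∶ B ! e →
           R ﹔ Γ ⊢ lam M ∶ (A ⟶[ e ] B) ! ∅ₑ
  t-app  : ∀ {M N A B e₁ e₂ e₃} →
           R ﹔ Γ ⊢ M ∶ (A ⟶[ e₂ ] B) ! e₁ → R ﹔ Γ ⊢ N ∶ A ! e₃ →
           R ﹔ Γ ⊢ app M N ∶ B ! (e₁ ++ e₂ ++ e₃)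
  t-get  : ∀ {M r A e} → R ﹔ Γ ⊢ M ∶ Reg r A ! e →
           R ﹔ Γ ⊢ get M ∶ A ! (e ++ r ∷ [])
  t-set  : ∀ {M N r A e₁ e₂} → R ﹔ Γ ⊢ M ∶ Reg r A ! e₁ → R ﹔ Γ ⊢ N ∶ A ! e₂ →
           R ﹔ Γ ⊢ set M N ∶ 𝟙 ! (e₁ ++ e₂ ++ r ∷ [])
  t-sub  : ∀ {M A e A' e'} → R ﹔ Γ ⊢ M ∶ A ! e → R ⊢ A ! e ≤ A' ! e' →
           R ﹔ Γ ⊢ M ∶ A' ! e'

_≥ᴿ_ : RCtx → RCtx → Set
R' ≥ᴿ R = R' ⊢ctx × Σ RCtx (λ R'' → R' ≡ R ++ᴿ R'')

-- ⟦ R ⟧ R'        : the store [[R]](R')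
-- ⟦ R ⊢ A , e ⟧ R' M  :  R' ⊢ M ∈ [[R ⊢ (A,e)]]
-- 𝒞 A R R'' M'    :  the condition C(A,R,R'',M')
⟦_⟧ᴿ : RCtx → RCtx → Store
⟦_⊢_,_⟧ : RCtx → Ty → Eff → RCtx → Term 0 → Set
𝒞 : Ty → RCtx → RCtx → Term 0 → Set

dom (⟦ ε ⟧ᴿ R')         s   = ⊥
val (⟦ ε ⟧ᴿ R')         s V = ⊥
dom (⟦ R , r ∶ A ⟧ᴿ R') s   = s ≡ r ⊎ dom (⟦ R ⟧ᴿ R') s
val (⟦ R , r ∶ A ⟧ᴿ R') s V =
  (s ≡ r × Val V × ⟦ R ⊢ A , ∅ₑ ⟧ R' V) ⊎ val (⟦ R ⟧ᴿ R') s V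

⟦ R ⊢ A , e ⟧ R' M =
    R' ≥ᴿ R
  × R' ﹔ [] ⊢ M ∶ A ! e
  × (∀ R'' → R'' ≥ᴿ R' → SN M (⟦ R ⟧ᴿ R''))
  × (∀ R'' → R'' ≥ᴿ R' → ∀ M' Δ → M , ⟦ R ⟧ᴿ R'' ⇓ M' , Δ →
       ((⟦ R ⟧ᴿ R'' ⊕ Δ) ≈ˢ ⟦ R ⟧ᴿ R'') × 𝒞 A R R'' M')

𝒞 𝟙              R R'' M' = M' ≡ unit
𝒞 (Reg r B)      R R'' M' = M' ≡ reg r
𝒞 (A₁ ⟶[ e' ] A₂) R R'' M' =
  Σ (Term 1) λ N → M' ≡ lam N
    × (∀ R₁ → R₁ ≥ᴿ R'' → ∀ V → Val V →
         ⟦ R ⊢ A₁ , ∅ₑ ⟧ R₁ V → ⟦ R ⊢ A₂ , e' ⟧ R₁ (app M' V))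

module Submission where

-- The interpretation quantifies over all reduction
-- sequences (strong normalisation plus a condition on every normal form),
-- so we first recast it through the inductive predicate  Safe S Q c :
-- "every reduction from c terminates and every normal form satisfies Q".
-- Safe composes along evaluation frames, is invariant under stores with the
-- same contents, and carries typing along by subject reduction.
--
-- Two semantic facts about the interpretation are needed for get and set,
-- because the store  ⟦ R ⟧ᴿ R''  binds  r_i  to values of  ⟦ R_{r_i} ⊢ A_i ⟧:
--   * prefix independence: for A well formed in R₀, ⟦ R₀ ⊢ A , e ⟧ and
--     ⟦ R₀ ++ R₁ ⊢ A , e ⟧ coincide, since a term only touches the regions
--     of its effect (step-locality);
--   * inhabitation: every well-formed type has a value in its
--     interpretation, so get on a region of R never gets stuck.

open import Defs
open import Data.Nat using (ℕ; suc)
open import Data.Fin using (Fin; zero; suc)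
open import Data.List using (List; []; _∷_; _++_)
open import Data.List.Relation.Unary.Any using (here; there)
open import Data.List.Membership.Propositional using (_∈_)
open import Data.List.Membership.Propositional.Properties using (∈-++⁻; ∈-map⁻)
open import Data.List.Relation.Binary.Subset.Propositional using (_⊆_)
open import Data.List.Relation.Binary.Subset.Propositional.Properties
  using (⊆-refl; ⊆-trans; xs⊆xs++ys; xs⊆ys++xs)
open import Data.Vec using (Vec; []; _∷_; lookup)
open import Data.Product using (Σ; _×_; _,_; proj₁; proj₂)
open import Data.Sum using (_⊎_; inj₁; inj₂)
open import Data.Empty using (⊥-elim)
open import Relation.Binary.PropositionalEquality
  using (_≡_; refl; sym; trans; cong; cong₂; _≗_; module ≡-Reasoning)
  renaming (subst to ≡subst)
open import Relation.Nullary using (¬_)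
open import Relation.Binary.Construct.Closure.ReflexiveTransitive using (Star; ε; _◅_)
open import Induction.WellFounded using (Acc; acc)

∈ᴿ⇒dom : ∀ {r A R} → r ∶ A ∈ᴿ R → r ∈ domᴿ R
∈ᴿ⇒dom here      = here refl
∈ᴿ⇒dom (there p) = there (∈ᴿ⇒dom p)

dom⇒∈ᴿ : ∀ {r R} → r ∈ domᴿ R → Σ Ty λ A → r ∶ A ∈ᴿ R
dom⇒∈ᴿ {R = R , s ∶ B} (here refl) = B , here
dom⇒∈ᴿ {R = R , s ∶ B} (there p)   = proj₁ (dom⇒∈ᴿ p) , there (proj₂ (dom⇒∈ᴿ p))

_⊑_ : RCtx → RCtx → Set
R ⊑ R' = ∀ {r A} → r ∶ A ∈ᴿ R → r ∶ A ∈ᴿ R'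

⊑-++ : ∀ R R₁ → R ⊑ (R ++ᴿ R₁)
⊑-++ R ε            p = p
⊑-++ R (R₁ , s ∶ B) p = there (⊑-++ R R₁ p)

⊑-dom : ∀ {R R' e} → R ⊑ R' → e ⊆ domᴿ R → e ⊆ domᴿ R'
⊑-dom w s x = ∈ᴿ⇒dom (w (proj₂ (dom⇒∈ᴿ (s x))))

≥⇒⊑ : ∀ {R R'} → R' ≥ᴿ R → R ⊑ R'
≥⇒⊑ {R} (_ , R₁ , refl) = ⊑-++ R R₁

ty-ctx : ∀ {R A} → R ⊢ty A → R ⊢ctx
ty-ctx (wf-𝟙 c)       = c
ty-ctx (wf-reg c _)   = c
ty-ctx (wf-arr a _ _) = ty-ctx a

wk-ty : ∀ {R R' A} → R ⊑ R' → R' ⊢ctx → R ⊢ty A → R' ⊢ty A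
wk-ty w c (wf-𝟙 _)       = wf-𝟙 c
wk-ty w c (wf-reg _ p)   = wf-reg c (w p)
wk-ty w c (wf-arr a b s) = wf-arr (wk-ty w c a) (wk-ty w c b) (⊑-dom w s)

prefix-ctx : ∀ R R₁ → (R ++ᴿ R₁) ⊢ctx → R ⊢ctx
prefix-ctx R ε            c            = c
prefix-ctx R (R₁ , s ∶ B) (wf-ext t _) = prefix-ctx R R₁ (ty-ctx t)

≥-ctx : ∀ {R R'} → R' ≥ᴿ R → R ⊢ctx
≥-ctx {R} (c , R₁ , refl) = prefix-ctx R R₁ c

lookup-wf : ∀ {R r A} → R ⊢ctx → r ∶ A ∈ᴿ R → R ⊢ty A
lookup-wf c@(wf-ext t _) here      = wk-ty there c t
lookup-wf c@(wf-ext t _) (there p) = wk-ty there c (lookup-wf (ty-ctx t) p)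

-- Regions of a well-formed context are distinct, so their types are unique.
unique : ∀ {R r A B} → R ⊢ctx → r ∶ A ∈ᴿ R → r ∶ B ∈ᴿ R → A ≡ B
unique c              here      here      = refl
unique (wf-ext _ nd) here      (there q) = ⊥-elim (nd (∈ᴿ⇒dom q))
unique (wf-ext _ nd) (there p) here      = ⊥-elim (nd (∈ᴿ⇒dom p))
unique (wf-ext t _)  (there p) (there q) = unique (ty-ctx t) p q

++ᴿ-assoc : ∀ R R₁ R₂ → (R ++ᴿ R₁) ++ᴿ R₂ ≡ R ++ᴿ (R₁ ++ᴿ R₂)
++ᴿ-assoc R R₁ ε            = refl
++ᴿ-assoc R R₁ (R₂ , s ∶ B) = cong (λ X → X , s ∶ B) (++ᴿ-assoc R R₁ R₂)

≥-refl : ∀ {R} → R ⊢ctx → R ≥ᴿ R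
≥-refl c = c , ε , refl

≥-trans : ∀ {R R₁ R₂} → R₂ ≥ᴿ R₁ → R₁ ≥ᴿ R → R₂ ≥ᴿ R
≥-trans {R} (c , X , refl) (_ , Y , refl) = c , (Y ++ᴿ X) , ++ᴿ-assoc R Y X

≥-prefix : ∀ {R R₁ R'} → R' ≥ᴿ (R ++ᴿ R₁) → R' ≥ᴿ R
≥-prefix {R} {R₁} (c , X , refl) = c , (R₁ ++ᴿ X) , ++ᴿ-assoc R R₁ X

-- Splitting a context at one of its regions:  R = (R₀ , r ∶ A) ++ R₁,
-- so that R₀ is the prefix R_r of the paper.
Split : RCtx → RCtx → Region → Ty → RCtx → Set
Split R R₀ r A R₁ = R ≡ (R₀ , r ∶ A) ++ᴿ R₁

split : ∀ {R r A} → r ∶ A ∈ᴿ R → Σ RCtx λ R₀ → Σ RCtx λ R₁ → Split R R₀ r A R₁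
split (here {R = R}) = R , ε , refl
split (there {s = s} {B = B} p) with split p
... | R₀ , R₁ , eq = R₀ , (R₁ , s ∶ B) , cong (λ X → X , s ∶ B) eq

split-mem : ∀ {R R₀ R₁ r A} → Split R R₀ r A R₁ → r ∶ A ∈ᴿ R
split-mem {R₀ = R₀} {R₁} refl = ⊑-++ (R₀ , _ ∶ _) R₁ here

split-≥ : ∀ {R R₀ R₁ r A R'} → Split R R₀ r A R₁ → R' ≥ᴿ R → R' ≥ᴿ R₀
split-≥ {R₀ = R₀} {R₁} {r} {A} refl g = ≥-prefix {R₀} {ε , r ∶ A} (≥-prefix {R₀ , r ∶ A} {R₁} g)

split-ty : ∀ {R R₀ R₁ r A} → Split R R₀ r A R₁ → R ⊢ctx → R₀ ⊢ty A
split-ty {R₀ = R₀} {R₁} {r} {A} refl c with prefix-ctx (R₀ , r ∶ A) R₁ c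
... | wf-ext t _ = t

-- Substitution algebra

ext-cong : ∀ {m n} {ρ ρ' : Fin m → Fin n} → ρ ≗ ρ' → ext ρ ≗ ext ρ'
ext-cong h zero    = refl
ext-cong h (suc i) = cong suc (h i)

rename-cong : ∀ {m n} {ρ ρ' : Fin m → Fin n} → ρ ≗ ρ' → rename ρ ≗ rename ρ'
rename-cong h (var i)   = cong var (h i)
rename-cong h (reg r)   = refl
rename-cong h unit      = refl
rename-cong h (lam M)   = cong lam (rename-cong (ext-cong h) M)
rename-cong h (app M N) = cong₂ app (rename-cong h M) (rename-cong h N)
rename-cong h (get M)   = cong get (rename-cong h M)
rename-cong h (set M N) = cong₂ set (rename-cong h M) (rename-cong h N)

exts-cong : ∀ {m n} {σ σ' : Fin m → Term n} → σ ≗ σ' → exts σ ≗ exts σ'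
exts-cong h zero    = refl
exts-cong h (suc i) = cong (rename suc) (h i)

subst-cong : ∀ {m n} {σ σ' : Fin m → Term n} → σ ≗ σ' → subst σ ≗ subst σ'
subst-cong h (var i)   = h i
subst-cong h (reg r)   = refl
subst-cong h unit      = refl
subst-cong h (lam M)   = cong lam (subst-cong (exts-cong h) M)
subst-cong h (app M N) = cong₂ app (subst-cong h M) (subst-cong h N)
subst-cong h (get M)   = cong get (subst-cong h M)
subst-cong h (set M N) = cong₂ set (subst-cong h M) (subst-cong h N)

rename-rename : ∀ {l m n} (ρ : Fin m → Fin n) (ρ' : Fin l → Fin m) M →
  rename ρ (rename ρ' M) ≡ rename (λ i → ρ (ρ' i)) M
rename-rename ρ ρ' (var i)   = refl
rename-rename ρ ρ' (reg r)   = refl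
rename-rename ρ ρ' unit      = refl
rename-rename ρ ρ' (lam M)   = cong lam (trans (rename-rename (ext ρ) (ext ρ') M)
  (rename-cong (λ { zero → refl ; (suc i) → refl }) M))
rename-rename ρ ρ' (app M N) = cong₂ app (rename-rename ρ ρ' M) (rename-rename ρ ρ' N)
rename-rename ρ ρ' (get M)   = cong get (rename-rename ρ ρ' M)
rename-rename ρ ρ' (set M N) = cong₂ set (rename-rename ρ ρ' M) (rename-rename ρ ρ' N)

subst-rename : ∀ {l m n} (τ : Fin m → Term n) (ρ : Fin l → Fin m) M →
  subst τ (rename ρ M) ≡ subst (λ i → τ (ρ i)) M
subst-rename τ ρ (var i)   = refl
subst-rename τ ρ (reg r)   = refl
subst-rename τ ρ unit      = refl
subst-rename τ ρ (lam M)   = cong lam (trans (subst-rename (exts τ) (ext ρ) M)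
  (subst-cong (λ { zero → refl ; (suc i) → refl }) M))
subst-rename τ ρ (app M N) = cong₂ app (subst-rename τ ρ M) (subst-rename τ ρ N)
subst-rename τ ρ (get M)   = cong get (subst-rename τ ρ M)
subst-rename τ ρ (set M N) = cong₂ set (subst-rename τ ρ M) (subst-rename τ ρ N)

rename-subst : ∀ {l m n} (ρ : Fin m → Fin n) (σ : Fin l → Term m) M →
  rename ρ (subst σ M) ≡ subst (λ i → rename ρ (σ i)) M
rename-subst ρ σ (var i)   = refl
rename-subst ρ σ (reg r)   = refl
rename-subst ρ σ unit      = refl
rename-subst ρ σ (lam M)   = cong lam (trans (rename-subst (ext ρ) (exts σ) M) (subst-cong exts-comm M))
  where
  exts-comm : (λ i → rename (ext ρ) (exts σ i)) ≗ exts (λ i → rename ρ (σ i))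
  exts-comm zero    = refl
  exts-comm (suc i) = trans (rename-rename (ext ρ) suc (σ i)) (sym (rename-rename suc ρ (σ i)))
rename-subst ρ σ (app M N) = cong₂ app (rename-subst ρ σ M) (rename-subst ρ σ N)
rename-subst ρ σ (get M)   = cong get (rename-subst ρ σ M)
rename-subst ρ σ (set M N) = cong₂ set (rename-subst ρ σ M) (rename-subst ρ σ N)

subst-subst : ∀ {l m n} (τ : Fin m → Term n) (σ : Fin l → Term m) M →
  subst τ (subst σ M) ≡ subst (λ i → subst τ (σ i)) M
subst-subst τ σ (var i)   = refl
subst-subst τ σ (reg r)   = refl
subst-subst τ σ unit      = refl
subst-subst τ σ (lam M)   = cong lam (trans (subst-subst (exts τ) (exts σ) M) (subst-cong exts-comm M))
  where
  exts-comm : (λ i → subst (exts τ) (exts σ i)) ≗ exts (λ i → subst τ (σ i))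
  exts-comm zero    = refl
  exts-comm (suc i) = trans (subst-rename (exts τ) suc (σ i)) (sym (rename-subst suc τ (σ i)))
subst-subst τ σ (app M N) = cong₂ app (subst-subst τ σ M) (subst-subst τ σ N)
subst-subst τ σ (get M)   = cong get (subst-subst τ σ M)
subst-subst τ σ (set M N) = cong₂ set (subst-subst τ σ M) (subst-subst τ σ N)

subst-id : ∀ {n} (M : Term n) → subst var M ≡ M
subst-id (var i)   = refl
subst-id (reg r)   = refl
subst-id unit      = refl
subst-id (lam M)   = cong lam (trans (subst-cong (λ { zero → refl ; (suc i) → refl }) M) (subst-id M))
subst-id (app M N) = cong₂ app (subst-id M) (subst-id N)
subst-id (get M)   = cong get (subst-id M)
subst-id (set M N) = cong₂ set (subst-id M) (subst-id N)

single : ∀ {n} → Term n → Fin (suc n) → Term n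
single V zero    = V
single V (suc i) = var i

[]-single : ∀ {n} (M : Term (suc n)) V → M [ V ] ≡ subst (single V) M
[]-single M V = subst-cong (λ { zero → refl ; (suc i) → refl }) M

_∷ˢ_ : ∀ {n} → Term 0 → (Fin n → Term 0) → Fin (suc n) → Term 0
(W ∷ˢ σ) zero    = W
(W ∷ˢ σ) (suc i) = σ i

-- β-reducing a closed instance of a λ-body is closing with the extended
-- substitution; this is the substitution fact behind the λ case.
exts-[] : ∀ {n} (σ : Fin n → Term 0) (M : Term (suc n)) W →
  (subst (exts σ) M) [ W ] ≡ subst (W ∷ˢ σ) M
exts-[] σ M W = begin
  subst (exts σ) M [ W ]                             ≡⟨ []-single (subst (exts σ) M) W ⟩
  subst (single W) (subst (exts σ) M)                ≡⟨ subst-subst (single W) (exts σ) M ⟩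
  subst (λ i → subst (single W) (exts σ i)) M        ≡⟨ subst-cong pointwise M ⟩
  subst (W ∷ˢ σ) M                                   ∎
  where
  open ≡-Reasoning
  pointwise : (λ i → subst (single W) (exts σ i)) ≗ (W ∷ˢ σ)
  pointwise zero    = refl
  pointwise (suc i) = trans (subst-rename (single W) suc (σ i)) (subst-id (σ i))

weaken-[] : (V W : Term 0) → (rename suc V) [ W ] ≡ V
weaken-[] V W = begin
  rename suc V [ W ]                  ≡⟨ []-single (rename suc V) W ⟩
  subst (single W) (rename suc V)     ≡⟨ subst-rename (single W) suc V ⟩
  subst var V                         ≡⟨ subst-id V ⟩
  V                                   ∎
  where open ≡-Reasoning

[]-⊆ : ∀ {xs : Eff} → [] ⊆ xs
[]-⊆ ()

++-⊆ : ∀ {xs ys zs : Eff} → xs ⊆ zs → ys ⊆ zs → (xs ++ ys) ⊆ zs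
++-⊆ {xs} p q m with ∈-++⁻ xs m
... | inj₁ a = p a
... | inj₂ b = q b

⊆-first : (e₁ e₂ e₃ : Eff) → e₁ ⊆ (e₁ ++ e₂ ++ e₃)
⊆-first e₁ e₂ e₃ = xs⊆xs++ys e₁ (e₂ ++ e₃)

⊆-second : (e₁ e₂ e₃ : Eff) → e₂ ⊆ (e₁ ++ e₂ ++ e₃)
⊆-second e₁ e₂ e₃ = ⊆-trans (xs⊆xs++ys e₂ e₃) (xs⊆ys++xs (e₂ ++ e₃) e₁)

⊆-third : (e₁ e₂ e₃ : Eff) → e₃ ⊆ (e₁ ++ e₂ ++ e₃)
⊆-third e₁ e₂ e₃ = ⊆-trans (xs⊆ys++xs e₃ e₂) (xs⊆ys++xs (e₂ ++ e₃) e₁)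

∈-last : ∀ {r} (e : Eff) → r ∈ (e ++ r ∷ [])
∈-last {r} e = xs⊆ys++xs (r ∷ []) e (here refl)

-- Typing metatheory

typing-ctx : ∀ {n R} {Γ : Vec Ty n} {M A e} → R ﹔ Γ ⊢ M ∶ A ! e → R ⊢Γ Γ
typing-ctx (t-var g)     = g
typing-ctx (t-reg g _)   = g
typing-ctx (t-unit g)    = g
typing-ctx (t-lam d)     = proj₁ (typing-ctx d) , λ i → proj₂ (typing-ctx d) (suc i)
typing-ctx (t-app d _)   = typing-ctx d
typing-ctx (t-get d)     = typing-ctx d
typing-ctx (t-set d _)   = typing-ctx d
typing-ctx (t-sub d _)   = typing-ctx d

≤-regular : ∀ {R A B} → R ⊢ A ≤ B → R ⊢ty A × R ⊢ty B
≤-regular (≤-refl a)        = a , a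
≤-regular (≤-arr p q s1 s2) =
  wf-arr (proj₂ (≤-regular p)) (proj₁ (≤-regular q)) (⊆-trans s1 s2) ,
  wf-arr (proj₁ (≤-regular p)) (proj₂ (≤-regular q)) s2

typing-regular : ∀ {n R} {Γ : Vec Ty n} {M A e} → R ﹔ Γ ⊢ M ∶ A ! e → R ⊢ A ! e
typing-regular (t-var (c , g))   = g _ , []-⊆
typing-regular (t-reg (c , g) p) = wf-reg c p , []-⊆
typing-regular (t-unit (c , g))  = wf-𝟙 c , []-⊆
typing-regular (t-lam d)         =
  wf-arr (proj₂ (typing-ctx d) zero) (proj₁ (typing-regular d)) (proj₂ (typing-regular d)) , []-⊆
typing-regular (t-app d₁ d₂) with typing-regular d₁
... | wf-arr a b s , s₁ = b , ++-⊆ s₁ (++-⊆ s (proj₂ (typing-regular d₂)))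
typing-regular (t-get d) with typing-regular d
... | wf-reg c p , s = lookup-wf c p , ++-⊆ s (λ { (here refl) → ∈ᴿ⇒dom p })
typing-regular (t-set d₁ d₂) with typing-regular d₁
... | wf-reg c p , s =
  wf-𝟙 c , ++-⊆ s (++-⊆ (proj₂ (typing-regular d₂)) (λ { (here refl) → ∈ᴿ⇒dom p }))
typing-regular (t-sub d (le , s1 , s2)) = proj₂ (≤-regular le) , s2

≤-trans : ∀ {R A B C} → R ⊢ A ≤ B → R ⊢ B ≤ C → R ⊢ A ≤ C
≤-trans (≤-refl _)            q                       = q
≤-trans p@(≤-arr _ _ _ _)     (≤-refl _)              = p
≤-trans (≤-arr p q s1 s2) (≤-arr p' q' s1' s2') =
  ≤-arr (≤-trans p' p) (≤-trans q q') (⊆-trans s1 s1') s2'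

wk-≤ : ∀ {R R' A B} → R ⊑ R' → R' ⊢ctx → R ⊢ A ≤ B → R' ⊢ A ≤ B
wk-≤ w c (≤-refl a)        = ≤-refl (wk-ty w c a)
wk-≤ w c (≤-arr p q s1 s2) = ≤-arr (wk-≤ w c p) (wk-≤ w c q) s1 (⊑-dom w s2)

wk-typing : ∀ {n R R'} {Γ : Vec Ty n} {M A e} → R ⊑ R' → R' ⊢ctx →
  R ﹔ Γ ⊢ M ∶ A ! e → R' ﹔ Γ ⊢ M ∶ A ! e
wk-typing {R' = R'} w c = go
  where
  wkΓ : ∀ {n} (Γ : Vec Ty n) → _ ⊢Γ Γ → R' ⊢Γ Γ
  wkΓ Γ (_ , g) = c , λ i → wk-ty w c (g i)
  go : ∀ {n} {Γ : Vec Ty n} {M A e} → _ ﹔ Γ ⊢ M ∶ A ! e → R' ﹔ Γ ⊢ M ∶ A ! e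
  go {Γ = Γ} (t-var g)        = t-var (wkΓ Γ g)
  go {Γ = Γ} (t-reg g p)      = t-reg (wkΓ Γ g) (w p)
  go {Γ = Γ} (t-unit g)       = t-unit (wkΓ Γ g)
  go (t-lam d)                = t-lam (go d)
  go (t-app d₁ d₂)            = t-app (go d₁) (go d₂)
  go (t-get d)                = t-get (go d)
  go (t-set d₁ d₂)            = t-set (go d₁) (go d₂)
  go (t-sub d (le , s1 , s2)) = t-sub (go d) (wk-≤ w c le , s1 , ⊑-dom w s2)

wk-≥ : ∀ {n R R'} {Γ : Vec Ty n} {M A e} → R' ≥ᴿ R →
  R ﹔ Γ ⊢ M ∶ A ! e → R' ﹔ Γ ⊢ M ∶ A ! e
wk-≥ h = wk-typing (≥⇒⊑ h) (proj₁ h)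

ren-typing : ∀ {m n R} {Γ : Vec Ty m} {Δ : Vec Ty n} {M A e} → R ﹔ Γ ⊢ M ∶ A ! e →
  (ρ : Fin m → Fin n) → (∀ i → lookup Δ (ρ i) ≡ lookup Γ i) → R ⊢Γ Δ →
  R ﹔ Δ ⊢ rename ρ M ∶ A ! e
ren-typing (t-var {i = i} g) ρ h gΔ = ≡subst (λ T → _ ﹔ _ ⊢ var (ρ i) ∶ T ! ∅ₑ) (h i) (t-var gΔ)
ren-typing (t-reg g p)       ρ h gΔ = t-reg gΔ p
ren-typing (t-unit g)        ρ h gΔ = t-unit gΔ
ren-typing {R = R} {Γ} {Δ} (t-lam {A = A} d) ρ h gΔ =
  t-lam (ren-typing d (ext ρ) ext-agrees (proj₁ gΔ , ext-wf))
  where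
  ext-agrees : ∀ i → lookup (A ∷ Δ) (ext ρ i) ≡ lookup (A ∷ Γ) i
  ext-agrees zero    = refl
  ext-agrees (suc i) = h i
  ext-wf : ∀ i → R ⊢ty lookup (A ∷ Δ) i
  ext-wf zero    = proj₂ (typing-ctx d) zero
  ext-wf (suc i) = proj₂ gΔ i
ren-typing (t-app d₁ d₂)     ρ h gΔ = t-app (ren-typing d₁ ρ h gΔ) (ren-typing d₂ ρ h gΔ)
ren-typing (t-get d)         ρ h gΔ = t-get (ren-typing d ρ h gΔ)
ren-typing (t-set d₁ d₂)     ρ h gΔ = t-set (ren-typing d₁ ρ h gΔ) (ren-typing d₂ ρ h gΔ)
ren-typing (t-sub d le)      ρ h gΔ = t-sub (ren-typing d ρ h gΔ) le

subst-typing : ∀ {m n R} {Γ : Vec Ty m} {Δ : Vec Ty n} {M A e} → R ﹔ Γ ⊢ M ∶ A ! e →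
  (σ : Fin m → Term n) → (∀ i → R ﹔ Δ ⊢ σ i ∶ lookup Γ i ! ∅ₑ) → R ⊢Γ Δ →
  R ﹔ Δ ⊢ subst σ M ∶ A ! e
subst-typing (t-var {i = i} g) σ h gΔ = h i
subst-typing (t-reg g p)       σ h gΔ = t-reg gΔ p
subst-typing (t-unit g)        σ h gΔ = t-unit gΔ
subst-typing {R = R} {Γ} {Δ} (t-lam {A = A} d) σ h gΔ = t-lam (subst-typing d (exts σ) exts-typed gΔ')
  where
  gΔ' : R ⊢Γ (A ∷ Δ)
  gΔ' = proj₁ gΔ , λ { zero → proj₂ (typing-ctx d) zero ; (suc i) → proj₂ gΔ i }
  exts-typed : ∀ i → R ﹔ (A ∷ Δ) ⊢ exts σ i ∶ lookup (A ∷ Γ) i ! ∅ₑ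
  exts-typed zero    = t-var gΔ'
  exts-typed (suc i) = ren-typing (h i) suc (λ _ → refl) gΔ'
subst-typing (t-app d₁ d₂)     σ h gΔ = t-app (subst-typing d₁ σ h gΔ) (subst-typing d₂ σ h gΔ)
subst-typing (t-get d)         σ h gΔ = t-get (subst-typing d σ h gΔ)
subst-typing (t-set d₁ d₂)     σ h gΔ = t-set (subst-typing d₁ σ h gΔ) (subst-typing d₂ σ h gΔ)
subst-typing (t-sub d le)      σ h gΔ = t-sub (subst-typing d σ h gΔ) le

β-typing : ∀ {R N V A B e} → R ﹔ (A ∷ []) ⊢ N ∶ B ! e → R ﹔ [] ⊢ V ∶ A ! ∅ₑ →
  R ﹔ [] ⊢ N [ V ] ∶ B ! e
β-typing {R} {N} {V} {B = B} {e} d dV =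
  ≡subst (λ X → R ﹔ [] ⊢ X ∶ B ! e) (sym ([]-single N V))
    (subst-typing d (single V) (λ { zero → dV }) (typing-ctx dV))

inv-arr≤ : ∀ {R A B e T} → R ⊢ (A ⟶[ e ] B) ≤ T →
  Σ Ty λ A' → Σ Ty λ B' → Σ Eff λ e' →
    (T ≡ (A' ⟶[ e' ] B')) × R ⊢ A' ≤ A × R ⊢ B ≤ B' × e ⊆ e'
inv-arr≤ (≤-refl (wf-arr a b s)) = _ , _ , _ , refl , ≤-refl a , ≤-refl b , ⊆-refl
inv-arr≤ (≤-arr p q s1 s2)       = _ , _ , _ , refl , p , q , s1

inv-lam : ∀ {n R} {Γ : Vec Ty n} {N T e} → R ﹔ Γ ⊢ lam N ∶ T ! e →
  Σ Ty λ A → Σ Ty λ B → Σ Eff λ e₀ → (R ﹔ (A ∷ Γ) ⊢ N ∶ B ! e₀) × R ⊢ (A ⟶[ e₀ ] B) ≤ T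
inv-lam (t-lam d) = _ , _ , _ , d , ≤-refl (proj₁ (typing-regular (t-lam d)))
inv-lam (t-sub d (le , _)) with inv-lam d
... | A , B , e₀ , d' , le' = A , B , e₀ , d' , ≤-trans le' le

inv-reg : ∀ {n R} {Γ : Vec Ty n} {r T e} → R ﹔ Γ ⊢ reg r ∶ T ! e →
  Σ Ty λ A → (T ≡ Reg r A) × r ∶ A ∈ᴿ R
inv-reg (t-reg g p) = _ , refl , p
inv-reg (t-sub d (le , _)) with inv-reg d
inv-reg (t-sub d (≤-refl _ , _)) | A , refl , p = A , refl , p

value-pure : ∀ {n R} {Γ : Vec Ty n} {M A e} → Val M → R ﹔ Γ ⊢ M ∶ A ! e → R ﹔ Γ ⊢ M ∶ A ! ∅ₑ
value-pure v (t-reg g p)              = t-reg g p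
value-pure v (t-unit g)               = t-unit g
value-pure v (t-lam d)                = t-lam d
value-pure v (t-sub d (le , s1 , s2)) = t-sub (value-pure v d) (le , []-⊆ , []-⊆)

widen-eff : ∀ {n R} {Γ : Vec Ty n} {M A e e'} → R ﹔ Γ ⊢ M ∶ A ! e → e ⊆ e' → e' ⊆ domᴿ R →
  R ﹔ Γ ⊢ M ∶ A ! e'
widen-eff d s1 s2 = t-sub d (≤-refl (proj₁ (typing-regular d)) , s1 , s2)

app-lam-typing : ∀ {R N W A B e} → R ﹔ [] ⊢ lam N ∶ (A ⟶[ e ] B) ! ∅ₑ → R ﹔ [] ⊢ W ∶ A ! ∅ₑ →
  R ﹔ [] ⊢ app (lam N) W ∶ B ! e
app-lam-typing d₁ d₂ with typing-regular d₁
... | wf-arr _ _ s , _ = widen-eff (t-app d₁ d₂) (++-⊆ []-⊆ (++-⊆ ⊆-refl []-⊆)) s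

-- Structural reduction
--
-- Red is Step with the evaluation context unfolded into congruence rules,
-- so that properties of reduction can be proved by induction on steps.

data Red (S : Store) : Conf → Conf → Set where
  β-red    : ∀ {M V Δ} → Val V → Red S (app (lam M) V , Δ) (M [ V ] , Δ)
  get-red  : ∀ {r V Δ} → val (S ⊕ Δ) r V → Red S (get (reg r) , Δ) (V , Δ)
  set-red  : ∀ {r V Δ} → Val V → Red S (set (reg r) V , Δ) (unit , (r , V) ∷ Δ)
  appL-red : ∀ {M M' N Δ Δ'} → Red S (M , Δ) (M' , Δ') → Red S (app M N , Δ) (app M' N , Δ')
  appR-red : ∀ {V N N' Δ Δ'} → Val V → Red S (N , Δ) (N' , Δ') →
             Red S (app V N , Δ) (app V N' , Δ')
  getC-red : ∀ {M M' Δ Δ'} → Red S (M , Δ) (M' , Δ') → Red S (get M , Δ) (get M' , Δ')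
  setL-red : ∀ {M M' N Δ Δ'} → Red S (M , Δ) (M' , Δ') → Red S (set M N , Δ) (set M' N , Δ')
  setR-red : ∀ {V N N' Δ Δ'} → Val V → Red S (N , Δ) (N' , Δ') →
             Red S (set V N , Δ) (set V N' , Δ')

-- Red steps lie in Step, since they can be put into any evaluation context.
red-in : ∀ {S P P' Δ Δ'} (E : ECtx) → Red S (P , Δ) (P' , Δ') → Red S (plug E P , Δ) (plug E P' , Δ')
red-in hole         s = s
red-in (appL E M)   s = appL-red (red-in E s)
red-in (appR V v E) s = appR-red v (red-in E s)
red-in (getC E)     s = getC-red (red-in E s)
red-in (setL E M)   s = setL-red (red-in E s)
red-in (setR V v E) s = setR-red v (red-in E s)

Step→Red : ∀ {S c c'} → Step S c c' → Red S c c'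
Step→Red (β-step {E} v)   = red-in E (β-red v)
Step→Red (get-step {E} x) = red-in E (get-red x)
Step→Red (set-step {E} v) = red-in E (set-red v)

_∘ᴱ_ : ECtx → ECtx → ECtx
hole       ∘ᴱ F = F
appL E M   ∘ᴱ F = appL (E ∘ᴱ F) M
appR V v E ∘ᴱ F = appR V v (E ∘ᴱ F)
getC E     ∘ᴱ F = getC (E ∘ᴱ F)
setL E M   ∘ᴱ F = setL (E ∘ᴱ F) M
setR V v E ∘ᴱ F = setR V v (E ∘ᴱ F)

plug-∘ᴱ : ∀ E F P → plug (E ∘ᴱ F) P ≡ plug E (plug F P)
plug-∘ᴱ hole         F P = refl
plug-∘ᴱ (appL E M)   F P = cong (λ X → app X M) (plug-∘ᴱ E F P)
plug-∘ᴱ (appR V v E) F P = cong (app V) (plug-∘ᴱ E F P)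
plug-∘ᴱ (getC E)     F P = cong get (plug-∘ᴱ E F P)
plug-∘ᴱ (setL E M)   F P = cong (λ X → set X M) (plug-∘ᴱ E F P)
plug-∘ᴱ (setR V v E) F P = cong (set V) (plug-∘ᴱ E F P)

step-in : ∀ {S M M' Δ Δ'} (F : ECtx) → Step S (M , Δ) (M' , Δ') →
  Step S (plug F M , Δ) (plug F M' , Δ')
step-in F (β-step {E} {M} {V} v)
  rewrite sym (plug-∘ᴱ F E (app (lam M) V)) | sym (plug-∘ᴱ F E (M [ V ])) = β-step {E = F ∘ᴱ E} v
step-in F (get-step {E} {r} {V} x)
  rewrite sym (plug-∘ᴱ F E (get (reg r))) | sym (plug-∘ᴱ F E V) = get-step {E = F ∘ᴱ E} x
step-in F (set-step {E} {r} {V} v)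
  rewrite sym (plug-∘ᴱ F E (set (reg r) V)) | sym (plug-∘ᴱ F E unit) = set-step {E = F ∘ᴱ E} v

Red→Step : ∀ {S c c'} → Red S c c' → Step S c c'
Red→Step (β-red v)      = β-step {E = hole} v
Red→Step (get-red x)    = get-step {E = hole} x
Red→Step (set-red v)    = set-step {E = hole} v
Red→Step (appL-red {N = N} s)   = step-in (appL hole N) (Red→Step s)
Red→Step (appR-red {V = V} w s) = step-in (appR V w hole) (Red→Step s)
Red→Step (getC-red s)           = step-in (getC hole) (Red→Step s)
Red→Step (setL-red {N = N} s)   = step-in (setL hole N) (Red→Step s)
Red→Step (setR-red {V = V} w s) = step-in (setR V w hole) (Red→Step s)

Star-Red→Step : ∀ {S c c'} → Star (Red S) c c' → Star (Step S) c c'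
Star-Red→Step ε       = ε
Star-Red→Step (x ◅ p) = Red→Step x ◅ Star-Red→Step p

Star-Step→Red : ∀ {S c c'} → Star (Step S) c c' → Star (Red S) c c'
Star-Step→Red ε       = ε
Star-Step→Red (x ◅ p) = Step→Red x ◅ Star-Step→Red p

Acc-Step→Red : ∀ {S c} → Acc (λ c' c → Step S c c') c → Acc (λ c' c → Red S c c') c
Acc-Step→Red (acc rs) = acc (λ s → Acc-Step→Red (rs (Red→Step s)))

Acc-Red→Step : ∀ {S c} → Acc (λ c' c → Red S c c') c → Acc (λ c' c → Step S c c') c
Acc-Red→Step (acc rs) = acc (λ s → Acc-Red→Step (rs (Step→Red s)))

Final : Store → Conf → Set
Final S c = ∀ c' → ¬ Red S c c'

value-final : ∀ {S M Δ} → Val M → Final S (M , Δ)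
value-final v-reg  _ ()
value-final v-unit _ ()
value-final v-lam  _ ()

-- A step can only read bindings, so it survives enlarging the store.
Red-mono : ∀ {S S' c c'} → (∀ r V → val S r V → val S' r V) → Red S c c' → Red S' c c'
Red-mono f (β-red v)                = β-red v
Red-mono f (get-red {r} {V} (inj₁ x)) = get-red (inj₁ (f r V x))
Red-mono f (get-red (inj₂ y))       = get-red (inj₂ y)
Red-mono f (set-red v)              = set-red v
Red-mono f (appL-red s)             = appL-red (Red-mono f s)
Red-mono f (appR-red v s)           = appR-red v (Red-mono f s)
Red-mono f (getC-red s)             = getC-red (Red-mono f s)
Red-mono f (setL-red s)             = setL-red (Red-mono f s)
Red-mono f (setR-red v s)           = setR-red v (Red-mono f s)

-- Subject reduction and locality of effects

StoreTyped : RCtx → Store → Set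
StoreTyped R S = ∀ r V → val S r V → ∀ B → r ∶ B ∈ᴿ R → R ﹔ [] ⊢ V ∶ B ! ∅ₑ

StepWrites : RCtx → List Binding → List Binding → Eff → Set
StepWrites R Δ Δ' e =
  (Δ' ≡ Δ) ⊎ Σ Region λ r → Σ (Term 0) λ V →
    (Δ' ≡ (r , V) ∷ Δ) × r ∈ e × Val V × (∀ B → r ∶ B ∈ᴿ R → R ﹔ [] ⊢ V ∶ B ! ∅ₑ)

StepWrites-mono : ∀ {R Δ Δ' e e'} → StepWrites R Δ Δ' e → e ⊆ e' → StepWrites R Δ Δ' e'
StepWrites-mono (inj₁ x)                           s = inj₁ x
StepWrites-mono (inj₂ (r , V , eq , m , v , h)) s = inj₂ (r , V , eq , s m , v , h)

StoreTyped-step : ∀ {R S Δ Δ' e} → StoreTyped R (S ⊕ Δ) → StepWrites R Δ Δ' e →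
  StoreTyped R (S ⊕ Δ')
StoreTyped-step st (inj₁ refl) = st
StoreTyped-step st (inj₂ (r , V , refl , m , v , h)) r' V' (inj₁ x)           = st r' V' (inj₁ x)
StoreTyped-step st (inj₂ (r , V , refl , m , v , h)) r' V' (inj₂ (here refl)) = h
StoreTyped-step st (inj₂ (r , V , refl , m , v , h)) r' V' (inj₂ (there y))   = st r' V' (inj₂ y)

β-preservation : ∀ {R N W B e} → Val W → R ﹔ [] ⊢ app (lam N) W ∶ B ! e →
  R ﹔ [] ⊢ N [ W ] ∶ B ! e
β-preservation w (t-sub d (le , s1 , s2)) = t-sub (β-preservation w d) (le , s1 , s2)
β-preservation w dd@(t-app {e₁ = e₁} {e₂} {e₃} d₁ d₂) with inv-lam d₁
... | _ , _ , _ , dN , le with inv-arr≤ le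
... | _ , _ , _ , refl , p , q , s =
  t-sub (β-typing dN (t-sub (value-pure w d₂) (p , []-⊆ , []-⊆)))
        (q , ⊆-trans s (⊆-second e₁ e₂ e₃) , proj₂ (typing-regular dd))

subject-reduction : ∀ {R S M A e Δ M' Δ'} → R ﹔ [] ⊢ M ∶ A ! e → StoreTyped R (S ⊕ Δ) →
  Red S (M , Δ) (M' , Δ') → (R ﹔ [] ⊢ M' ∶ A ! e) × StepWrites R Δ Δ' e
subject-reduction (t-sub d (le , s1 , s2)) st s with subject-reduction d st s
... | d' , x = t-sub d' (le , s1 , s2) , StepWrites-mono x s1
subject-reduction d@(t-app _ _) st (β-red v) = β-preservation v d , inj₁ refl
subject-reduction (t-app d₁ d₂) st (appL-red s) with subject-reduction d₁ st s
... | d₁' , x = t-app d₁' d₂ , StepWrites-mono x (xs⊆xs++ys _ _)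
subject-reduction (t-app {e₁ = e₁} {e₂} {e₃} d₁ d₂) st (appR-red v s) with subject-reduction d₂ st s
... | d₂' , x = t-app d₁ d₂' , StepWrites-mono x (⊆-third e₁ e₂ e₃)
subject-reduction dd@(t-get d) st (get-red {r} {V} x) with inv-reg d
... | A , refl , p = widen-eff (st r V x _ p) []-⊆ (proj₂ (typing-regular dd)) , inj₁ refl
subject-reduction (t-get d) st (getC-red s) with subject-reduction d st s
... | d' , x = t-get d' , StepWrites-mono x (xs⊆xs++ys _ _)
subject-reduction dd@(t-set {e₁ = e₁} {e₂} d₁ d₂) st (set-red {r} {V} v) with inv-reg d₁
... | A , refl , p =
  widen-eff (t-unit (typing-ctx d₁)) []-⊆ (proj₂ (typing-regular dd)) ,
  inj₂ (r , V , refl , ⊆-third e₁ e₂ (r ∷ []) (here refl) , v ,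
        λ B q → ≡subst (λ T → _ ﹔ [] ⊢ V ∶ T ! ∅ₑ) (unique (proj₁ (typing-ctx d₁)) p q)
                       (value-pure v d₂))
subject-reduction (t-set d₁ d₂) st (setL-red s) with subject-reduction d₁ st s
... | d' , x = t-set d' d₂ , StepWrites-mono x (xs⊆xs++ys _ _)
subject-reduction (t-set {r = r} {e₁ = e₁} {e₂} d₁ d₂) st (setR-red v s) with subject-reduction d₂ st s
... | d' , x = t-set d₁ d' , StepWrites-mono x (⊆-second e₁ e₂ (r ∷ []))

step-local : ∀ {R S S' M A e Δ c} → R ﹔ [] ⊢ M ∶ A ! e →
  (∀ r → r ∈ e → ∀ V → val (S ⊕ Δ) r V → val (S' ⊕ Δ) r V) → Red S (M , Δ) c → Red S' (M , Δ) c
step-local (t-sub d (le , s1 , s2)) h s = step-local d (λ r m → h r (s1 m)) s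
step-local (t-app d₁ d₂) h (β-red v) = β-red v
step-local (t-app {e₁ = e₁} {e₂} {e₃} d₁ d₂) h (appL-red s) =
  appL-red (step-local d₁ (λ r m → h r (⊆-first e₁ e₂ e₃ m)) s)
step-local (t-app {e₁ = e₁} {e₂} {e₃} d₁ d₂) h (appR-red v s) =
  appR-red v (step-local d₂ (λ r m → h r (⊆-third e₁ e₂ e₃ m)) s)
step-local (t-get {e = e} d) h (get-red {r} {V} x) with inv-reg d
... | A , refl , p = get-red (h r (∈-last e) V x)
step-local (t-get d) h (getC-red s) = getC-red (step-local d (λ r m → h r (xs⊆xs++ys _ _ m)) s)
step-local (t-set d₁ d₂) h (set-red v) = set-red v
step-local (t-set {r = r} {e₁ = e₁} {e₂} d₁ d₂) h (setL-red s) =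
  setL-red (step-local d₁ (λ r' m → h r' (⊆-first e₁ e₂ (r ∷ []) m)) s)
step-local (t-set {r = r} {e₁ = e₁} {e₂} d₁ d₂) h (setR-red v s) =
  setR-red v (step-local d₂ (λ r' m → h r' (⊆-second e₁ e₂ (r ∷ []) m)) s)

-- Safe executions

data Safe (S : Store) (Q : Conf → Set) (c : Conf) : Set where
  safe : (∀ c' → Red S c c' → Safe S Q c') → (Final S c → Q c) → Safe S Q c

Safe-step : ∀ {S Q c} → Safe S Q c → ∀ c' → Red S c c' → Safe S Q c'
Safe-step (safe h q) = h

Safe-final : ∀ {S Q c} → Safe S Q c → Final S c → Q c
Safe-final (safe h q) = q

Safe-map : ∀ {S Q Q' c} → (∀ c → Q c → Q' c) → Safe S Q c → Safe S Q' c
Safe-map f (safe h q) = safe (λ c' s → Safe-map f (h c' s)) (λ fin → f _ (q fin))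

Safe→Acc : ∀ {S Q c} → Safe S Q c → Acc (λ c' c → Red S c c') c
Safe→Acc (safe h q) = acc (λ {c'} s → Safe→Acc (h c' s))

Safe-paths : ∀ {S Q c c'} → Safe S Q c → Star (Red S) c c' → Final S c' → Q c'
Safe-paths s ε        fin = Safe-final s fin
Safe-paths s (x ◅ p) fin = Safe-paths (Safe-step s _ x) p fin

Acc→Safe : ∀ {S Q c} → Acc (λ c' c → Red S c c') c →
  (∀ c' → Star (Red S) c c' → Final S c' → Q c') → Safe S Q c
Acc→Safe (acc rs) h =
  safe (λ c' s → Acc→Safe (rs s) (λ c'' p fin → h c'' (s ◅ p) fin)) (λ fin → h _ ε fin)

value-safe : ∀ {S Q M Δ} → Val M → Q (M , Δ) → Safe S Q (M , Δ)
value-safe v q = safe (λ c' s → ⊥-elim (value-final v c' s)) (λ _ → q)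

record SameContents (S₁ : Store) (Δ₁ : List Binding) (S₂ : Store) (Δ₂ : List Binding) : Set where
  constructor mkSame
  field same : ∀ r V → (val (S₁ ⊕ Δ₁) r V → val (S₂ ⊕ Δ₂) r V) × (val (S₂ ⊕ Δ₂) r V → val (S₁ ⊕ Δ₁) r V)
open SameContents public

SameContents-sym : ∀ {S₁ Δ₁ S₂ Δ₂} → SameContents S₁ Δ₁ S₂ Δ₂ → SameContents S₂ Δ₂ S₁ Δ₁
SameContents-sym (mkSame e) = mkSame λ r V → proj₂ (e r V) , proj₁ (e r V)

SameContents-∷ : ∀ {S₁ Δ₁ S₂ Δ₂} b → SameContents S₁ Δ₁ S₂ Δ₂ → SameContents S₁ (b ∷ Δ₁) S₂ (b ∷ Δ₂)
SameContents-∷ {S₁} {Δ₁} {S₂} {Δ₂} b (mkSame e) =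
  mkSame λ r V → add {S₁ = S₁} {Δ₁} {S₂} {Δ₂} (proj₁ (e r V)) , add {S₁ = S₂} {Δ₂} {S₁} {Δ₁} (proj₂ (e r V))
  where
  add : ∀ {r V S₁ Δ₁ S₂ Δ₂} → (val (S₁ ⊕ Δ₁) r V → val (S₂ ⊕ Δ₂) r V) →
        val (S₁ ⊕ (b ∷ Δ₁)) r V → val (S₂ ⊕ (b ∷ Δ₂)) r V
  add g (inj₂ (here eq)) = inj₂ (here eq)
  add g (inj₁ x) with g (inj₁ x)
  ... | inj₁ y = inj₁ y
  ... | inj₂ y = inj₂ (there y)
  add g (inj₂ (there m)) with g (inj₂ m)
  ... | inj₁ y = inj₁ y
  ... | inj₂ y = inj₂ (there y)

-- Reduction only observes the contents of the store.
simulate : ∀ {S₁ Δ₁ S₂ Δ₂ M M' Δ₁'} → SameContents S₁ Δ₁ S₂ Δ₂ → Red S₁ (M , Δ₁) (M' , Δ₁') →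
  Σ (List Binding) λ Δ₂' → Red S₂ (M , Δ₂) (M' , Δ₂') × SameContents S₁ Δ₁' S₂ Δ₂'
simulate e (β-red v)          = _ , β-red v , e
simulate e (get-red {r} {V} x) = _ , get-red (proj₁ (same e r V) x) , e
simulate e (set-red {r} {V} v) = _ , set-red v , SameContents-∷ (r , V) e
simulate e (appL-red s)   with simulate e s
... | Δ' , s' , e' = Δ' , appL-red s' , e'
simulate e (appR-red v s) with simulate e s
... | Δ' , s' , e' = Δ' , appR-red v s' , e'
simulate e (getC-red s)   with simulate e s
... | Δ' , s' , e' = Δ' , getC-red s' , e'
simulate e (setL-red s)   with simulate e s
... | Δ' , s' , e' = Δ' , setL-red s' , e'
simulate e (setR-red v s) with simulate e s
... | Δ' , s' , e' = Δ' , setR-red v s' , e'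

Safe-transport : ∀ {S₁ S₂ Q₁ Q₂ M Δ₁ Δ₂} → SameContents S₁ Δ₁ S₂ Δ₂ →
  (∀ M Δ Δ' → SameContents S₁ Δ S₂ Δ' → Q₁ (M , Δ) → Q₂ (M , Δ')) →
  Safe S₁ Q₁ (M , Δ₁) → Safe S₂ Q₂ (M , Δ₂)
Safe-transport {S₁} {S₂} {Q₁} {Q₂} {M} {Δ₁} {Δ₂} e resp (safe h q) = safe step fin
  where
  step : ∀ c' → Red S₂ (M , Δ₂) c' → Safe S₂ Q₂ c'
  step (M' , Δ₂') s with simulate (SameContents-sym e) s
  ... | Δ₁' , s' , e' = Safe-transport (SameContents-sym e') resp (h _ s')
  fin : Final S₂ (M , Δ₂) → Q₂ (M , Δ₂)
  fin f = resp M Δ₁ Δ₂ e (q (λ { (M' , Δ') s → f _ (proj₁ (proj₂ (simulate e s))) }))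

-- A frame F (one layer of evaluation context): steps of M lift to F M,
-- and every step of F M is a lifted step of M unless M is a value.
FrameStep : Store → (Term 0 → Term 0) → Term 0 → List Binding → Conf → Set
FrameStep S F M Δ c =
  (Σ (Term 0) λ M' → Σ (List Binding) λ Δ' → (c ≡ (F M' , Δ')) × Red S (M , Δ) (M' , Δ')) ⊎ Val M

Frame : Store → (Term 0 → Term 0) → Set
Frame S F = (∀ {M M' Δ Δ'} → Red S (M , Δ) (M' , Δ') → Red S (F M , Δ) (F M' , Δ')) ×
            (∀ {M Δ c} → Red S (F M , Δ) c → FrameStep S F M Δ c)

bind : ∀ {S Q Q' F M Δ} → Frame S F → Safe S Q (M , Δ) →
  (∀ M' Δ' → Q (M' , Δ') → Safe S Q' (F M' , Δ')) → Safe S Q' (F M , Δ)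
bind {S} {Q} {Q'} {F} {M} {Δ} fr (safe h q) k = safe step fin
  where
  step : ∀ c' → Red S (F M , Δ) c' → Safe S Q' c'
  step c' s with proj₂ fr s
  ... | inj₁ (M' , Δ' , refl , s') = bind fr (h _ s') k
  ... | inj₂ v = Safe-step (k M Δ (q (value-final v))) c' s
  fin : Final S (F M , Δ) → Q' (F M , Δ)
  fin f = Safe-final (k M Δ (q (λ c s → f _ (proj₁ fr s)))) f

frame-appL : ∀ {S} N → Frame S (λ M → app M N)
frame-appL N = appL-red , inv
  where
  inv : ∀ {S M Δ c} → Red S (app M N , Δ) c → FrameStep S (λ M → app M N) M Δ c
  inv (β-red v)      = inj₂ v-lam
  inv (appL-red s)   = inj₁ (_ , _ , refl , s)
  inv (appR-red v s) = inj₂ v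

frame-appR : ∀ {S V} → Val V → Frame S (app V)
frame-appR {V = V} w = appR-red w , inv
  where
  inv : ∀ {S M Δ c} → Red S (app V M , Δ) c → FrameStep S (app V) M Δ c
  inv (β-red v)      = inj₂ v
  inv (appL-red s)   = ⊥-elim (value-final w _ s)
  inv (appR-red v s) = inj₁ (_ , _ , refl , s)

frame-get : ∀ {S} → Frame S get
frame-get = getC-red , inv
  where
  inv : ∀ {S M Δ c} → Red S (get M , Δ) c → FrameStep S get M Δ c
  inv (get-red x)  = inj₂ v-reg
  inv (getC-red s) = inj₁ (_ , _ , refl , s)

frame-setL : ∀ {S} N → Frame S (λ M → set M N)
frame-setL N = setL-red , inv
  where
  inv : ∀ {S M Δ c} → Red S (set M N , Δ) c → FrameStep S (λ M → set M N) M Δ c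
  inv (set-red v)    = inj₂ v-reg
  inv (setL-red s)   = inj₁ (_ , _ , refl , s)
  inv (setR-red v s) = inj₂ v

frame-setR : ∀ {S V} → Val V → Frame S (set V)
frame-setR {V = V} w = setR-red w , inv
  where
  inv : ∀ {S M Δ c} → Red S (set V M , Δ) c → FrameStep S (set V) M Δ c
  inv (set-red v)    = inj₂ v
  inv (setL-red s)   = ⊥-elim (value-final w _ s)
  inv (setR-red v s) = inj₁ (_ , _ , refl , s)

β-safe : ∀ {S Q N W Δ} → Val W → Safe S Q (N [ W ] , Δ) → Safe S Q (app (lam N) W , Δ)
β-safe {S} {Q} {N} {W} {Δ} w s = safe step (λ fin → ⊥-elim (fin _ (β-red w)))
  where
  step : ∀ c' → Red S (app (lam N) W , Δ) c' → Safe S Q c'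
  step _ (β-red v)       = s
  step _ (appL-red s')   = ⊥-elim (value-final v-lam _ s')
  step _ (appR-red v s') = ⊥-elim (value-final w _ s')

get-safe : ∀ {S Q r Δ} → (∀ V → val (S ⊕ Δ) r V → Safe S Q (V , Δ)) →
  Σ (Term 0) (λ V → val (S ⊕ Δ) r V) → Safe S Q (get (reg r) , Δ)
get-safe {S} {Q} {r} {Δ} h (V₀ , x₀) = safe step (λ fin → ⊥-elim (fin _ (get-red x₀)))
  where
  step : ∀ c' → Red S (get (reg r) , Δ) c' → Safe S Q c'
  step _ (get-red x)  = h _ x
  step _ (getC-red s) = ⊥-elim (value-final v-reg _ s)

set-safe : ∀ {S Q r W Δ} → Val W → Q (unit , (r , W) ∷ Δ) → Safe S Q (set (reg r) W , Δ)
set-safe {S} {Q} {r} {W} {Δ} w q = safe step (λ fin → ⊥-elim (fin _ (set-red w)))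
  where
  step : ∀ c' → Red S (set (reg r) W , Δ) c' → Safe S Q c'
  step _ (set-red v)     = value-safe v-unit q
  step _ (setL-red s)    = ⊥-elim (value-final v-reg _ s)
  step _ (setR-red v s)  = ⊥-elim (value-final w _ s)

Typed : RCtx → Ty → Eff → Conf → Set
Typed R A e (M , Δ) = R ﹔ [] ⊢ M ∶ A ! e

Safe-typed : ∀ {S Q R A e M Δ} → Safe S Q (M , Δ) → R ﹔ [] ⊢ M ∶ A ! e → StoreTyped R (S ⊕ Δ) →
  Safe S (λ c → Q c × Typed R A e c) (M , Δ)
Safe-typed {S} {Q} {R} {A} {e} {M} {Δ} (safe h q) d st = safe step (λ fin → q fin , d)
  where
  step : ∀ c' → Red S (M , Δ) c' → Safe S (λ c → Q c × Typed R A e c) c'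
  step (M' , Δ') s with subject-reduction d st s
  ... | d' , w = Safe-typed (h _ s) d' (StoreTyped-step {S = S} {Δ = Δ} st w)

val-inv : ∀ R {R'' r V} → val (⟦ R ⟧ᴿ R'') r V →
  Σ RCtx λ R₀ → Σ Ty λ A → Σ RCtx λ R₁ → Split R R₀ r A R₁ × Val V × ⟦ R₀ ⊢ A , ∅ₑ ⟧ R'' V
val-inv ε ()
val-inv (R , s ∶ B) (inj₁ (refl , v , g)) = R , B , ε , refl , v , g
val-inv (R , s ∶ B) (inj₂ x) with val-inv R x
... | R₀ , A , R₁ , eq , v , g = R₀ , A , (R₁ , s ∶ B) , cong (λ X → X , s ∶ B) eq , v , g

val-intro : ∀ R₀ R₁ {r A R'' V} → Val V → ⟦ R₀ ⊢ A , ∅ₑ ⟧ R'' V →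
  val (⟦ (R₀ , r ∶ A) ++ᴿ R₁ ⟧ᴿ R'') r V
val-intro R₀ ε            v g = inj₁ (refl , v , g)
val-intro R₀ (R₁ , s ∶ B) v g = inj₂ (val-intro R₀ R₁ v g)

val→dom : ∀ R {R'' r V} → val (⟦ R ⟧ᴿ R'') r V → dom (⟦ R ⟧ᴿ R'') r
val→dom ε ()
val→dom (R , s ∶ B) (inj₁ (eq , _)) = inj₁ eq
val→dom (R , s ∶ B) (inj₂ x)        = inj₂ (val→dom R x)

val-mono : ∀ R₀ R₁ {R'' r V} → val (⟦ R₀ ⟧ᴿ R'') r V → val (⟦ R₀ ++ᴿ R₁ ⟧ᴿ R'') r V
val-mono R₀ ε            x = x
val-mono R₀ (R₁ , s ∶ B) x = inj₂ (val-mono R₀ R₁ x)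

val-restrict : ∀ R₀ R₁ {R'' r V} → (R₀ ++ᴿ R₁) ⊢ctx → r ∈ domᴿ R₀ →
  val (⟦ R₀ ++ᴿ R₁ ⟧ᴿ R'') r V → val (⟦ R₀ ⟧ᴿ R'') r V
val-restrict R₀ ε            c m x = x
val-restrict R₀ (R₁ , s ∶ B) (wf-ext t nd) m (inj₁ (refl , _)) =
  ⊥-elim (nd (∈ᴿ⇒dom (⊑-++ R₀ R₁ (proj₂ (dom⇒∈ᴿ m)))))
val-restrict R₀ (R₁ , s ∶ B) (wf-ext t nd) m (inj₂ x) = val-restrict R₀ R₁ (ty-ctx t) m x

StoreTyped-⟦⟧ : ∀ {R R''} → R'' ≥ᴿ R → StoreTyped R'' (⟦ R ⟧ᴿ R'')
StoreTyped-⟦⟧ {R} {R''} h r V x B p with val-inv R x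
... | R₀ , A , R₁ , eq , v , (_ , d , _) =
  ≡subst (λ T → R'' ﹔ [] ⊢ V ∶ T ! ∅ₑ) (unique (proj₁ h) (≥⇒⊑ h (split-mem eq)) p) d

-- The bindings Δ added to S only repeat values already stored in S; this
-- is the "final store equals the initial store" clause of the interpretation.
record Conservative (S : Store) (Δ : List Binding) : Set where
  constructor mkCons
  field conserved : ∀ r V → val (S ⊕ Δ) r V → val S r V
open Conservative public

-- Elementary facts about conservative extensions; Conservative S Δ is
-- equivalent to the store equation  S ⊕ Δ ≈ S  of the interpretation.
Conservative-[] : ∀ {S} → Conservative S []
Conservative-[] = mkCons λ { r V (inj₁ x) → x ; r V (inj₂ ()) }

Conservative→Same : ∀ {S Δ} → Conservative S Δ → SameContents S Δ S []
Conservative→Same {S} i =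
  mkSame λ r V → (λ x → inj₁ (conserved i r V x)) , (λ x → inj₁ (conserved (Conservative-[] {S}) r V x))

StoreTyped-Conservative : ∀ {R R'' Δ} → R'' ≥ᴿ R → Conservative (⟦ R ⟧ᴿ R'') Δ →
  StoreTyped R'' (⟦ R ⟧ᴿ R'' ⊕ Δ)
StoreTyped-Conservative h i r V x = StoreTyped-⟦⟧ h r V (conserved i r V x)

Conservative→≈ : ∀ R {R'' Δ} → Conservative (⟦ R ⟧ᴿ R'') Δ → (⟦ R ⟧ᴿ R'' ⊕ Δ) ≈ˢ ⟦ R ⟧ᴿ R''
Conservative→≈ R {R''} {Δ} i = (λ r → dom-back r , inj₁) , (λ r V → conserved i r V , inj₁)
  where
  dom-back : ∀ r → dom (⟦ R ⟧ᴿ R'' ⊕ Δ) r → dom (⟦ R ⟧ᴿ R'') r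
  dom-back r (inj₁ x) = x
  dom-back r (inj₂ m) with ∈-map⁻ proj₁ m
  ... | (r' , V) , m' , refl = val→dom R (conserved i r V (inj₂ m'))

≈→Conservative : ∀ {S Δ} → (S ⊕ Δ) ≈ˢ S → Conservative S Δ
≈→Conservative eq = mkCons λ r V → proj₁ (proj₂ eq r V)

-- The interpretation as safe execution

Post : RCtx → Ty → RCtx → Conf → Set
Post R A R'' (M , Δ) = Conservative (⟦ R ⟧ᴿ R'') Δ × 𝒞 A R R'' M

Post-resp : ∀ {R A R''} M Δ Δ' → SameContents (⟦ R ⟧ᴿ R'') Δ (⟦ R ⟧ᴿ R'') Δ' →
  Post R A R'' (M , Δ) → Post R A R'' (M , Δ')
Post-resp M Δ Δ' e (i , c) = mkCons (λ r V x → conserved i r V (proj₂ (same e r V) x)) , c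

-- The interpretation, restated: R' ⊢ M ∈ ⟦ R ⊢ (A , e) ⟧ iff M is typed and
-- its execution is safe for Post in every larger world.
interp→safe : ∀ {R A e R' M R''} → ⟦ R ⊢ A , e ⟧ R' M → R'' ≥ᴿ R' →
  Safe (⟦ R ⟧ᴿ R'') (Post R A R'') (M , [])
interp→safe {R} {A} {e} {R'} {M} {R''} (_ , _ , sn , ev) h = Acc→Safe (Acc-Step→Red (sn R'' h)) post
  where
  post : ∀ c' → Star (Red (⟦ R ⟧ᴿ R'')) (M , []) c' → Final (⟦ R ⟧ᴿ R'') c' → Post R A R'' c'
  post (M' , Δ) p fin with ev R'' h M' Δ (Star-Red→Step p , (λ c s → fin c (Step→Red s)))
  ... | eq , c = ≈→Conservative eq , c

safe→interp : ∀ {R A e R' M} → R' ≥ᴿ R → R' ﹔ [] ⊢ M ∶ A ! e →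
  (∀ R'' → R'' ≥ᴿ R' → Safe (⟦ R ⟧ᴿ R'') (Post R A R'') (M , [])) → ⟦ R ⊢ A , e ⟧ R' M
safe→interp {R} h d k =
  h , d , (λ R'' h'' → Acc-Red→Step (Safe→Acc (k R'' h''))) ,
  λ R'' h'' M' Δ (p , fin) →
    let q = Safe-paths (k R'' h'') (Star-Step→Red p) (λ c s → fin c (Red→Step s))
    in Conservative→≈ R (proj₁ q) , proj₂ q

interp-≥ : ∀ {R A e R' M} → ⟦ R ⊢ A , e ⟧ R' M → R' ≥ᴿ R
interp-≥ = proj₁

interp-typed : ∀ {R A e R' M} → ⟦ R ⊢ A , e ⟧ R' M → R' ﹔ [] ⊢ M ∶ A ! e
interp-typed g = proj₁ (proj₂ g)

interp-mono : ∀ {R A e R' R₁ M} → ⟦ R ⊢ A , e ⟧ R' M → R₁ ≥ᴿ R' → ⟦ R ⊢ A , e ⟧ R₁ M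
interp-mono (h , d , sn , ev) h₁ =
  ≥-trans h₁ h , wk-≥ h₁ d , (λ R'' h'' → sn R'' (≥-trans h'' h₁)) , (λ R'' h'' → ev R'' (≥-trans h'' h₁))

𝒞-mono : ∀ A {R R'' R₃ M} → 𝒞 A R R'' M → R₃ ≥ᴿ R'' → 𝒞 A R R₃ M
𝒞-mono 𝟙              c h = c
𝒞-mono (Reg r B)      c h = c
𝒞-mono (A₁ ⟶[ e ] A₂) (N , eq , f) h = N , eq , λ R₁ h₁ → f R₁ (≥-trans h₁ h)

𝒞-val : ∀ A {R R'' M} → 𝒞 A R R'' M → Val M
𝒞-val 𝟙              refl             = v-unit
𝒞-val (Reg r B)      refl             = v-reg
𝒞-val (A₁ ⟶[ e ] A₂) (N , refl , f) = v-lam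

value-interp : ∀ {R A e R' V} → Val V → R' ≥ᴿ R → R' ﹔ [] ⊢ V ∶ A ! e → 𝒞 A R R' V →
  ⟦ R ⊢ A , e ⟧ R' V
value-interp {A = A} v h d c =
  safe→interp h d (λ R'' h'' → value-safe v (Conservative-[] , 𝒞-mono A c h''))

-- An interpreted value satisfies 𝒞 (it is its own normal form).
interp-value-𝒞 : ∀ {R A e R' V} → Val V → ⟦ R ⊢ A , e ⟧ R' V → 𝒞 A R R' V
interp-value-𝒞 v g = proj₂ (Safe-final (interp→safe g (≥-refl (proj₁ (interp-≥ g)))) (value-final v))

interp-sub : ∀ {R A A' e e' R' M} → R ⊢ A ≤ A' → e ⊆ e' → e' ⊆ domᴿ R →
  ⟦ R ⊢ A , e ⟧ R' M → ⟦ R ⊢ A' , e' ⟧ R' M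
𝒞-sub : ∀ {R A A' R'' M} → R ⊢ A ≤ A' → 𝒞 A R R'' M → 𝒞 A' R R'' M
interp-sub le s1 s2 g =
  safe→interp (interp-≥ g)
    (t-sub (interp-typed g) (wk-≤ (≥⇒⊑ (interp-≥ g)) (proj₁ (interp-≥ g)) le , s1 , ⊑-dom (≥⇒⊑ (interp-≥ g)) s2))
    (λ R'' h → Safe-map (λ { (M , Δ) (i , c) → i , 𝒞-sub le c }) (interp→safe g h))
𝒞-sub (≤-refl _)        c              = c
𝒞-sub (≤-arr p q s1 s2) (N , eq , f) =
  N , eq , λ R₁ h V v gV → interp-sub q s1 s2 (f R₁ h V v (interp-sub p ⊆-refl []-⊆ gV))

lam-interp : ∀ {R R' N A B e e'} → R' ≥ᴿ R → R' ﹔ [] ⊢ lam N ∶ (A ⟶[ e ] B) ! e' →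
  (∀ R₁ → R₁ ≥ᴿ R' → ∀ W → Val W → ⟦ R ⊢ A , ∅ₑ ⟧ R₁ W → ⟦ R ⊢ B , e ⟧ R₁ (N [ W ])) →
  ⟦ R ⊢ A ⟶[ e ] B , e' ⟧ R' (lam N)
lam-interp {R} {R'} {N} {A} {B} {e} h d body = value-interp v-lam h d (N , refl , applied)
  where
  applied : ∀ R₁ → R₁ ≥ᴿ R' → ∀ W → Val W → ⟦ R ⊢ A , ∅ₑ ⟧ R₁ W → ⟦ R ⊢ B , e ⟧ R₁ (app (lam N) W)
  applied R₁ h₁ W w gW =
    safe→interp (interp-≥ gW) (app-lam-typing (wk-≥ h₁ (value-pure v-lam d)) (interp-typed gW))
      (λ R'' h'' → β-safe w (interp→safe (body R₁ h₁ W w gW) h''))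

-- Inhabitation: every well-formed type has a value in its interpretation

interp-inhabited : ∀ {R₀ A R''} → R₀ ⊢ty A → R'' ≥ᴿ R₀ →
  Σ (Term 0) λ V → Val V × ⟦ R₀ ⊢ A , ∅ₑ ⟧ R'' V
interp-inhabited (wf-𝟙 _) h =
  unit , v-unit , value-interp v-unit h (t-unit (proj₁ h , λ ())) refl
interp-inhabited (wf-reg _ p) h =
  reg _ , v-reg , value-interp v-reg h (t-reg (proj₁ h , λ ()) (≥⇒⊑ h p)) refl
interp-inhabited {R₀} {A₁ ⟶[ e ] A₂} {R''} (wf-arr a b s) h with interp-inhabited b h
... | V₂ , v₂ , g₂ = lam (rename suc V₂) , v-lam , lam-interp h constant-typing constant-body
  where
  -- the constant function  λx. V₂
  constant-typing : R'' ﹔ [] ⊢ lam (rename suc V₂) ∶ (A₁ ⟶[ e ] A₂) ! ∅ₑ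
  constant-typing =
    t-lam (widen-eff (ren-typing (interp-typed g₂) suc (λ ()) (proj₁ h , λ { zero → wk-ty (≥⇒⊑ h) (proj₁ h) a }))
                     []-⊆ (⊑-dom (≥⇒⊑ h) s))
  constant-body : ∀ R₁ → R₁ ≥ᴿ R'' → ∀ W → Val W → ⟦ R₀ ⊢ A₁ , ∅ₑ ⟧ R₁ W →
    ⟦ R₀ ⊢ A₂ , e ⟧ R₁ (rename suc V₂ [ W ])
  constant-body R₁ h₁ W w gW =
    ≡subst (⟦ R₀ ⊢ A₂ , e ⟧ R₁) (sym (weaken-[] V₂ W)) (interp-sub (≤-refl b) []-⊆ s (interp-mono g₂ h₁))

-- Prefix independence of the interpretation
--
-- The two stores ⟦ R₀ ⟧ᴿ and ⟦ R₀ ++ R₁ ⟧ᴿ agree on dom R₀, and a term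
-- with effect e ⊆ dom R₀ neither reads nor writes outside it.

WritesWithin : RCtx → List Binding → Set
WritesWithin R₀ Δ = ∀ r V → (r , V) ∈ Δ → r ∈ domᴿ R₀

WritesWithin-step : ∀ {R₀ R'' Δ Δ' e} → WritesWithin R₀ Δ → StepWrites R'' Δ Δ' e → e ⊆ domᴿ R₀ →
  WritesWithin R₀ Δ'
WritesWithin-step d (inj₁ refl) se = d
WritesWithin-step d (inj₂ (r , V , refl , m , _)) se r' V' (here refl) = se m
WritesWithin-step d (inj₂ (r , V , refl , m , _)) se r' V' (there x)   = d r' V' x

module PrefixTransfer (R₀ R₁ R'' : RCtx) (c : (R₀ ++ᴿ R₁) ⊢ctx) where
  S₀ S₁ : Store
  S₀ = ⟦ R₀ ⟧ᴿ R''
  S₁ = ⟦ R₀ ++ᴿ R₁ ⟧ᴿ R''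

  reads-agree : ∀ {e Δ} → e ⊆ domᴿ R₀ → ∀ r → r ∈ e → ∀ V → val (S₁ ⊕ Δ) r V → val (S₀ ⊕ Δ) r V
  reads-agree se r m V (inj₁ x) = inj₁ (val-restrict R₀ R₁ c (se m) x)
  reads-agree se r m V (inj₂ y) = inj₂ y

  safe-up : ∀ {A e Q₀ Q M Δ} → e ⊆ domᴿ R₀ →
    (∀ M Δ → WritesWithin R₀ Δ → Q₀ (M , Δ) → Q (M , Δ)) →
    R'' ﹔ [] ⊢ M ∶ A ! e → StoreTyped R'' (S₁ ⊕ Δ) → WritesWithin R₀ Δ →
    Safe S₀ Q₀ (M , Δ) → Safe S₁ Q (M , Δ)
  safe-up {Q₀ = Q₀} {Q} {M} {Δ} se conv d st dm (safe h q) = safe step fin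
    where
    step : ∀ c' → Red S₁ (M , Δ) c' → Safe S₁ Q c'
    step (M' , Δ') s with subject-reduction d st s
    ... | d' , w = safe-up se conv d' (StoreTyped-step {S = S₁} {Δ = Δ} st w) (WritesWithin-step dm w se)
                     (h _ (step-local d (reads-agree se) s))
    fin : Final S₁ (M , Δ) → Q (M , Δ)
    fin f = conv M Δ dm (q (λ c' s₀ → f c' (Red-mono (λ r V → val-mono R₀ R₁) s₀)))

  safe-down : ∀ {A e Q₀ Q M Δ} → e ⊆ domᴿ R₀ →
    (∀ M Δ → WritesWithin R₀ Δ → Q (M , Δ) → Q₀ (M , Δ)) →
    R'' ﹔ [] ⊢ M ∶ A ! e → StoreTyped R'' (S₁ ⊕ Δ) → WritesWithin R₀ Δ →
    Safe S₁ Q (M , Δ) → Safe S₀ Q₀ (M , Δ)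
  safe-down {Q₀ = Q₀} {Q} {M} {Δ} se conv d st dm (safe h q) = safe step fin
    where
    step : ∀ c' → Red S₀ (M , Δ) c' → Safe S₀ Q₀ c'
    step (M' , Δ') s₀ with Red-mono (λ r V → val-mono R₀ R₁) s₀
    ... | s with subject-reduction d st s
    ... | d' , w = safe-down se conv d' (StoreTyped-step {S = S₁} {Δ = Δ} st w) (WritesWithin-step dm w se)
                     (h _ s)
    fin : Final S₀ (M , Δ) → Q₀ (M , Δ)
    fin f = conv M Δ dm (q (λ c' s → f c' (step-local d (reads-agree se) s)))

  conservative-up : ∀ {Δ} → Conservative S₀ Δ → Conservative S₁ Δ
  conservative-up i = mkCons λ { r V (inj₁ y) → y ; r V (inj₂ m) → val-mono R₀ R₁ (conserved i r V (inj₂ m)) }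

  conservative-down : ∀ {Δ} → WritesWithin R₀ Δ → Conservative S₁ Δ → Conservative S₀ Δ
  conservative-down dm i = mkCons λ
    { r V (inj₁ y) → y
    ; r V (inj₂ m) → val-restrict R₀ R₁ c (dm r V m) (conserved i r V (inj₂ m)) }

open PrefixTransfer using (safe-up; safe-down; conservative-up; conservative-down)

-- Prefix independence, proved jointly with its analogue for 𝒞 (by
-- induction on the type, since 𝒞 at an arrow refers back to ⟦_⟧).
interp-prefix : ∀ R₀ R₁ A e → R₀ ⊢ty A → e ⊆ domᴿ R₀ → ∀ {R' M} → R' ≥ᴿ (R₀ ++ᴿ R₁) →
  (⟦ R₀ ⊢ A , e ⟧ R' M → ⟦ R₀ ++ᴿ R₁ ⊢ A , e ⟧ R' M) × (⟦ R₀ ++ᴿ R₁ ⊢ A , e ⟧ R' M → ⟦ R₀ ⊢ A , e ⟧ R' M)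
𝒞-prefix : ∀ R₀ R₁ A → R₀ ⊢ty A → ∀ {R'' M} → R'' ≥ᴿ (R₀ ++ᴿ R₁) →
  (𝒞 A R₀ R'' M → 𝒞 A (R₀ ++ᴿ R₁) R'' M) × (𝒞 A (R₀ ++ᴿ R₁) R'' M → 𝒞 A R₀ R'' M)
interp-prefix R₀ R₁ A e a se {R'} {M} h = up , down
  where
  c : (R₀ ++ᴿ R₁) ⊢ctx
  c = ≥-ctx h
  store-ok : ∀ {R''} → R'' ≥ᴿ R' → StoreTyped R'' (⟦ R₀ ++ᴿ R₁ ⟧ᴿ R'' ⊕ [])
  store-ok {R''} h'' = StoreTyped-Conservative (≥-trans h'' h) (Conservative-[] {⟦ R₀ ++ᴿ R₁ ⟧ᴿ R''})
  up : ⟦ R₀ ⊢ A , e ⟧ R' M → ⟦ R₀ ++ᴿ R₁ ⊢ A , e ⟧ R' M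
  up g = safe→interp h (interp-typed g) λ R'' h'' →
    safe-up R₀ R₁ R'' c se
      (λ M Δ dm (i , cc) → conservative-up R₀ R₁ R'' c i , proj₁ (𝒞-prefix R₀ R₁ A a (≥-trans h'' h)) cc)
      (wk-≥ h'' (interp-typed g)) (store-ok h'') (λ _ _ ()) (interp→safe g h'')
  down : ⟦ R₀ ++ᴿ R₁ ⊢ A , e ⟧ R' M → ⟦ R₀ ⊢ A , e ⟧ R' M
  down g = safe→interp (≥-prefix h) (interp-typed g) λ R'' h'' →
    safe-down R₀ R₁ R'' c se
      (λ M Δ dm (i , cc) → conservative-down R₀ R₁ R'' c dm i , proj₂ (𝒞-prefix R₀ R₁ A a (≥-trans h'' h)) cc)
      (wk-≥ h'' (interp-typed g)) (store-ok h'') (λ _ _ ()) (interp→safe g h'')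
𝒞-prefix R₀ R₁ 𝟙         a h = (λ x → x) , (λ x → x)
𝒞-prefix R₀ R₁ (Reg r B) a h = (λ x → x) , (λ x → x)
𝒞-prefix R₀ R₁ (A₁ ⟶[ e ] A₂) (wf-arr a b s) {R''} h =
  (λ { (N , eq , f) → N , eq , λ R₂ h₂ V v gV → proj₁ (codomain h₂) (f R₂ h₂ V v (proj₂ (domain h₂) gV)) }) ,
  (λ { (N , eq , f) → N , eq , λ R₂ h₂ V v gV → proj₂ (codomain h₂) (f R₂ h₂ V v (proj₁ (domain h₂) gV)) })
  where
  domain : ∀ {R₂ V} → R₂ ≥ᴿ R'' →
    (⟦ R₀ ⊢ A₁ , ∅ₑ ⟧ R₂ V → ⟦ R₀ ++ᴿ R₁ ⊢ A₁ , ∅ₑ ⟧ R₂ V) × (⟦ R₀ ++ᴿ R₁ ⊢ A₁ , ∅ₑ ⟧ R₂ V → ⟦ R₀ ⊢ A₁ , ∅ₑ ⟧ R₂ V)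
  domain h₂ = interp-prefix R₀ R₁ A₁ [] a []-⊆ (≥-trans h₂ h)
  codomain : ∀ {R₂ M} → R₂ ≥ᴿ R'' →
    (⟦ R₀ ⊢ A₂ , e ⟧ R₂ M → ⟦ R₀ ++ᴿ R₁ ⊢ A₂ , e ⟧ R₂ M) × (⟦ R₀ ++ᴿ R₁ ⊢ A₂ , e ⟧ R₂ M → ⟦ R₀ ⊢ A₂ , e ⟧ R₂ M)
  codomain h₂ = interp-prefix R₀ R₁ A₂ e b s (≥-trans h₂ h)

-- The form in which prefix independence is used: for a region r : A of R,
-- the interpretation of A in R_r and in R coincide.
interp-at-region : ∀ {R R₀ R₁ r A R'' V} → Split R R₀ r A R₁ → R'' ≥ᴿ R →
  (⟦ R₀ ⊢ A , ∅ₑ ⟧ R'' V → ⟦ R ⊢ A , ∅ₑ ⟧ R'' V) × (⟦ R ⊢ A , ∅ₑ ⟧ R'' V → ⟦ R₀ ⊢ A , ∅ₑ ⟧ R'' V)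
interp-at-region {R₀ = R₀} {R₁} {r} {A} {R''} {V} refl h =
  ≡subst (λ X → R'' ≥ᴿ X → (⟦ R₀ ⊢ A , ∅ₑ ⟧ R'' V → ⟦ X ⊢ A , ∅ₑ ⟧ R'' V) × (⟦ X ⊢ A , ∅ₑ ⟧ R'' V → ⟦ R₀ ⊢ A , ∅ₑ ⟧ R'' V))
    (sym (++ᴿ-assoc R₀ (ε , r ∶ A) R₁))
    (interp-prefix R₀ ((ε , r ∶ A) ++ᴿ R₁) A [] (split-ty refl (≥-ctx h)) []-⊆) h

-- Compatibility lemmas

run-from : ∀ {R A e R' N R'' Δ} → ⟦ R ⊢ A , e ⟧ R' N → R'' ≥ᴿ R' → Conservative (⟦ R ⟧ᴿ R'') Δ →
  Safe (⟦ R ⟧ᴿ R'') (λ c → Post R A R'' c × Typed R'' A e c) (N , Δ)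
run-from {R} {A} {R'' = R''} {Δ} g h i =
  Safe-typed {Δ = Δ}
    (Safe-transport (SameContents-sym (Conservative→Same i)) (Post-resp {R} {A} {R''}) (interp→safe g h))
    (wk-≥ h (interp-typed g)) (StoreTyped-Conservative (≥-trans h (interp-≥ g)) i)

continue-from : ∀ {R A e R'' N Δ} → ⟦ R ⊢ A , e ⟧ R'' N → Conservative (⟦ R ⟧ᴿ R'') Δ →
  Safe (⟦ R ⟧ᴿ R'') (Post R A R'') (N , Δ)
continue-from g i = Safe-map (λ _ → proj₁) (run-from g (≥-refl (proj₁ (interp-≥ g))) i)

result-interp : ∀ {R A e R'' W Δ} → R'' ≥ᴿ R → Post R A R'' (W , Δ) × Typed R'' A e (W , Δ) →
  Val W × ⟦ R ⊢ A , ∅ₑ ⟧ R'' W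
result-interp {A = A} {W = W} h ((_ , cW) , dW) = w , value-interp w h (value-pure w dW) cW
  where
  w : Val W
  w = 𝒞-val A cW

app-compat : ∀ {R R' M N A B e₁ e₂ e₃} → R' ≥ᴿ R → R' ﹔ [] ⊢ app M N ∶ B ! (e₁ ++ e₂ ++ e₃) →
  ⟦ R ⊢ A ⟶[ e₂ ] B , e₁ ⟧ R' M → ⟦ R ⊢ A , e₃ ⟧ R' N → ⟦ R ⊢ B , e₁ ++ e₂ ++ e₃ ⟧ R' (app M N)
app-compat {R} {R'} {M} {N} {A} {B} {e₁} {e₂} {e₃} h d gM gN = safe→interp h d body
  where
  body : ∀ R'' → R'' ≥ᴿ R' → Safe (⟦ R ⟧ᴿ R'') (Post R B R'') (app M N , [])
  body R'' h'' = bind (frame-appL N) (interp→safe gM h'') function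
    where
    function : ∀ M' Δ₁ → Post R (A ⟶[ e₂ ] B) R'' (M' , Δ₁) →
      Safe (⟦ R ⟧ᴿ R'') (Post R B R'') (app M' N , Δ₁)
    function M' Δ₁ (i₁ , (N₀ , refl , f)) = bind (frame-appR v-lam) (run-from gN h'' i₁) argument
      where
      argument : ∀ W Δ₂ → Post R A R'' (W , Δ₂) × Typed R'' A e₃ (W , Δ₂) →
        Safe (⟦ R ⟧ᴿ R'') (Post R B R'') (app (lam N₀) W , Δ₂)
      argument W Δ₂ result with result-interp (≥-trans h'' h) result
      ... | w , gW = continue-from (f R'' (≥-refl (proj₁ h'')) W w gW) (proj₁ (proj₁ result))

-- The values stored at a region r : A of R are exactly the values of
-- ⟦ R ⊢ A ⟧ (by prefix independence), and there is at least one.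
stored-value : ∀ {R R'' r A V} → R'' ≥ᴿ R → r ∶ A ∈ᴿ R → val (⟦ R ⟧ᴿ R'') r V →
  Val V × ⟦ R ⊢ A , ∅ₑ ⟧ R'' V
stored-value {R} h p x with val-inv R x
... | R₀ , A' , R₁ , eq , v , g with unique (≥-ctx h) (split-mem eq) p
... | refl = v , proj₁ (interp-at-region eq h) g

storable-value : ∀ {R R'' r A V} → R'' ≥ᴿ R → r ∶ A ∈ᴿ R → Val V → ⟦ R ⊢ A , ∅ₑ ⟧ R'' V →
  val (⟦ R ⟧ᴿ R'') r V
storable-value {R} {R''} {r} {A} {V} h p v g with split p
... | R₀ , R₁ , eq =
  ≡subst (λ X → val (⟦ X ⟧ᴿ R'') r V) (sym eq) (val-intro R₀ R₁ v (proj₂ (interp-at-region eq h) g))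

region-inhabited : ∀ {R R'' r A} → R'' ≥ᴿ R → r ∶ A ∈ᴿ R → Σ (Term 0) λ V → val (⟦ R ⟧ᴿ R'') r V
region-inhabited {R} {R''} {r} h p with split p
... | R₀ , R₁ , eq with interp-inhabited (split-ty eq (≥-ctx h)) (split-≥ eq h)
... | V , v , g = V , ≡subst (λ X → val (⟦ X ⟧ᴿ R'') r V) (sym eq) (val-intro R₀ R₁ v g)

get-compat : ∀ {R R' M r A e} → R' ≥ᴿ R → R ⊢ty Reg r A → R' ﹔ [] ⊢ get M ∶ A ! (e ++ r ∷ []) →
  ⟦ R ⊢ Reg r A , e ⟧ R' M → ⟦ R ⊢ A , e ++ r ∷ [] ⟧ R' (get M)
get-compat {R} {R'} {M} {r} {A} h (wf-reg _ p) d gM = safe→interp h d body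
  where
  body : ∀ R'' → R'' ≥ᴿ R' → Safe (⟦ R ⟧ᴿ R'') (Post R A R'') (get M , [])
  body R'' h'' = bind frame-get (interp→safe gM h'') read
    where
    hR : R'' ≥ᴿ R
    hR = ≥-trans h'' h
    read : ∀ M' Δ₁ → Post R (Reg r A) R'' (M' , Δ₁) → Safe (⟦ R ⟧ᴿ R'') (Post R A R'') (get M' , Δ₁)
    read M' Δ₁ (i₁ , refl) = get-safe each some-value
      where
      some-value : Σ (Term 0) λ V → val (⟦ R ⟧ᴿ R'' ⊕ Δ₁) r V
      some-value with region-inhabited hR p
      ... | V₀ , x₀ = V₀ , inj₁ x₀
      each : ∀ V → val (⟦ R ⟧ᴿ R'' ⊕ Δ₁) r V → Safe (⟦ R ⟧ᴿ R'') (Post R A R'') (V , Δ₁)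
      each V x with stored-value hR p (conserved i₁ r V x)
      ... | v , g = value-safe v (i₁ , interp-value-𝒞 v g)

set-compat : ∀ {R R' M N r A e₁ e₂} → R' ≥ᴿ R → R ⊢ty Reg r A →
  R' ﹔ [] ⊢ set M N ∶ 𝟙 ! (e₁ ++ e₂ ++ r ∷ []) →
  ⟦ R ⊢ Reg r A , e₁ ⟧ R' M → ⟦ R ⊢ A , e₂ ⟧ R' N → ⟦ R ⊢ 𝟙 , e₁ ++ e₂ ++ r ∷ [] ⟧ R' (set M N)
set-compat {R} {R'} {M} {N} {r} {A} {e₁} {e₂} h (wf-reg _ p) d gM gN = safe→interp h d body
  where
  body : ∀ R'' → R'' ≥ᴿ R' → Safe (⟦ R ⟧ᴿ R'') (Post R 𝟙 R'') (set M N , [])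
  body R'' h'' = bind (frame-setL N) (interp→safe gM h'') region
    where
    hR : R'' ≥ᴿ R
    hR = ≥-trans h'' h
    region : ∀ M' Δ₁ → Post R (Reg r A) R'' (M' , Δ₁) → Safe (⟦ R ⟧ᴿ R'') (Post R 𝟙 R'') (set M' N , Δ₁)
    region M' Δ₁ (i₁ , refl) = bind (frame-setR v-reg) (run-from gN h'' i₁) write
      where
      -- the written value is storable, so the store stays conservative
      write : ∀ W Δ₂ → Post R A R'' (W , Δ₂) × Typed R'' A e₂ (W , Δ₂) →
        Safe (⟦ R ⟧ᴿ R'') (Post R 𝟙 R'') (set (reg r) W , Δ₂)
      write W Δ₂ result@((i₂ , _) , _) with result-interp hR result
      ... | w , gW = set-safe w (mkCons kept , refl)
        where
        kept : ∀ r' V' → val (⟦ R ⟧ᴿ R'' ⊕ ((r , W) ∷ Δ₂)) r' V' → val (⟦ R ⟧ᴿ R'') r' V'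
        kept r' V' (inj₁ y)           = y
        kept r' V' (inj₂ (here refl)) = storable-value hR p w gW
        kept r' V' (inj₂ (there m))   = conserved i₂ r' V' (inj₂ m)

closing-typing : ∀ {n R R'} {Γ : Vec Ty n} {M B e} {σ : Fin n → Term 0} →
  R ﹔ Γ ⊢ M ∶ B ! e → R' ≥ᴿ R → (∀ i → ⟦ R ⊢ lookup Γ i , ∅ₑ ⟧ R' (σ i)) →
  R' ﹔ [] ⊢ subst σ M ∶ B ! e
closing-typing {σ = σ} d h gσ = subst-typing (wk-≥ h d) σ (λ i → interp-typed (gσ i)) (proj₁ h , λ ())

extend-vals : ∀ {n W} {σ : Fin n → Term 0} → Val W → (∀ i → Val (σ i)) → ∀ i → Val ((W ∷ˢ σ) i)
extend-vals w vσ zero    = w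
extend-vals w vσ (suc i) = vσ i

extend-interp : ∀ {n R R' A W} {Γ : Vec Ty n} {σ : Fin n → Term 0} →
  ⟦ R ⊢ A , ∅ₑ ⟧ R' W → (∀ i → ⟦ R ⊢ lookup Γ i , ∅ₑ ⟧ R' (σ i)) →
  ∀ i → ⟦ R ⊢ lookup (A ∷ Γ) i , ∅ₑ ⟧ R' ((W ∷ˢ σ) i)
extend-interp gW gσ zero    = gW
extend-interp gW gσ (suc i) = gσ i

theorem1 : ∀ {n : ℕ} {R : RCtx} {Γ : Vec Ty n} {M : Term n} {B : Ty} {e : Eff} →
    R ﹔ Γ ⊢ M ∶ B ! e →
    ∀ (R' : RCtx) → R' ≥ᴿ R →
    ∀ (σ : Fin n → Term 0) → (∀ i → Val (σ i)) →
    (∀ i → ⟦ R ⊢ lookup Γ i , ∅ₑ ⟧ R' (σ i)) →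
    ⟦ R ⊢ B , e ⟧ R' (subst σ M)
theorem1 (t-var {i = i} _) R' h σ vσ gσ = gσ i
theorem1 d@(t-reg _ _)     R' h σ vσ gσ = value-interp v-reg h (closing-typing d h gσ) refl
theorem1 d@(t-unit _)      R' h σ vσ gσ = value-interp v-unit h (closing-typing d h gσ) refl
theorem1 {R = R} d@(t-lam {M = N} {B = B} {e = e} dN) R' h σ vσ gσ =
  lam-interp h (closing-typing d h gσ) λ R₁ h₁ W w gW →
    ≡subst (⟦ R ⊢ B , e ⟧ R₁) (sym (exts-[] σ N W))
      (theorem1 dN R₁ (≥-trans h₁ h) (W ∷ˢ σ) (extend-vals w vσ)
                (extend-interp gW (λ i → interp-mono (gσ i) h₁)))
theorem1 d@(t-app d₁ d₂) R' h σ vσ gσ =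
  app-compat h (closing-typing d h gσ) (theorem1 d₁ R' h σ vσ gσ) (theorem1 d₂ R' h σ vσ gσ)
theorem1 d@(t-get d₁) R' h σ vσ gσ =
  get-compat h (proj₁ (typing-regular d₁)) (closing-typing d h gσ) (theorem1 d₁ R' h σ vσ gσ)
theorem1 d@(t-set d₁ d₂) R' h σ vσ gσ =
  set-compat h (proj₁ (typing-regular d₁)) (closing-typing d h gσ)
    (theorem1 d₁ R' h σ vσ gσ) (theorem1 d₂ R' h σ vσ gσ)
theorem1 (t-sub d (le , s1 , s2)) R' h σ vσ gσ = interp-sub le s1 s2 (theorem1 d R' h σ vσ gσ)
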